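{- Let $i\geq 1$ and let $m$ be an integer with $5\nmid m$ such that $m=N_i(f)$ for some $f\in\mathbb Z[x]$. Then $m=N_i(1+(x-1)^3h(x))$ for some $h\in\mathbb Z[x]$. For $i=1$ one can also write $5m=N_1(1-x+5g(x))$ for some $g\in\mathbb Z[x]$, and if $m=N_1(1+(x-1)^3h(x))$ with $5\nmid h(1)$ then $g$ can be chosen with $5\nmid g(1)$.
   Context: For $k\ge1$, $\omega_k=e^{2\pi i/5^k}$ and for $G\in\mathbb Z[x]$, $N_k(G)=\prod_{1\le j\le 5^k,\ 5\nmid j}G(\omega_k^j)$. -}

module Defs where

open import Data.Nat as ℕ using (ℕ; zero; suc)
open import Data.Nat.Divisibility as ℕD using ()
open import Data.Integer as ℤ using (ℤ; +_; -[1+_])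
open import Data.List using (List; []; _∷_; map; filter; upTo; foldr)
open import Data.Product using (∃; ∃-syntax)
open import Relation.Nullary.Decidable using (¬?)
open import Relation.Binary.PropositionalEquality using (_≡_)

-- Polynomials in ℤ[x] as coefficient lists, lowest degree first.
-- Trailing zeros are allowed; equality of polynomials is coefficientwise (_≈ₚ_).
Poly : Set
Poly = List ℤ

coeff : Poly → ℕ → ℤ
coeff []      _       = + 0
coeff (a ∷ p) zero    = a
coeff (a ∷ p) (suc n) = coeff p n

infix 4 _≈ₚ_
_≈ₚ_ : Poly → Poly → Set
p ≈ₚ q = ∀ n → coeff p n ≡ coeff q n

infixl 6 _+ₚ_
_+ₚ_ : Poly → Poly → Poly
[]      +ₚ q       = q
(a ∷ p) +ₚ []      = a ∷ p
(a ∷ p) +ₚ (b ∷ q) = (a ℤ.+ b) ∷ (p +ₚ q)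

scale : ℤ → Poly → Poly
scale c = map (c ℤ.*_)

infixl 7 _*ₚ_
_*ₚ_ : Poly → Poly → Poly
[]      *ₚ q = []
(a ∷ p) *ₚ q = scale a q +ₚ (+ 0 ∷ (p *ₚ q))

negₚ : Poly → Poly
negₚ = scale (ℤ.- + 1)

const : ℤ → Poly
const c = c ∷ []

X : Poly
X = + 0 ∷ + 1 ∷ []

monomial : ℕ → Poly
monomial zero    = const (+ 1)
monomial (suc n) = + 0 ∷ monomial n

infixr 8 _^ₚ_
_^ₚ_ : Poly → ℕ → Poly
p ^ₚ zero  = const (+ 1)
p ^ₚ suc n = p *ₚ (p ^ₚ n)

compose : Poly → Poly → Poly
compose []      q = []
compose (a ∷ p) q = const a +ₚ q *ₚ compose p q

eval : Poly → ℤ → ℤ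
eval []      _ = + 0
eval (a ∷ p) t = a ℤ.+ t ℤ.* eval p t

-- Φ_{5^k}(x) = Σ_{t=0}^{4} x^{t·5^{k-1}}  (the minimal polynomial of ω_k, for k ≥ 1)
Φ5 : ℕ → Poly
Φ5 k = foldr (λ t acc → monomial (t ℕ.* 5 ℕ.^ (k ℕ.∸ 1)) +ₚ acc) [] (upTo 5)

units5 : ℕ → List ℕ
units5 k = filter (λ j → ¬? (5 ℕD.∣? j)) (map suc (upTo (5 ℕ.^ k)))

-- Π_{j} G(x^j), a polynomial whose image in ℤ[x]/(Φ_{5^k}) ≅ ℤ[ω_k] is N_k(G)
normProd : ℕ → Poly → Poly
normProd k G = foldr (λ j acc → compose G (monomial j) *ₚ acc) (const (+ 1)) (units5 k)

-- N_k(G) = m, computed in ℤ[ω_k] ≅ ℤ[x]/(Φ_{5^k}(x)) (x ↦ ω_k):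
-- Π_j G(x^j) ≡ m  (mod Φ_{5^k}) in ℤ[x].
NormIs : ℕ → Poly → ℤ → Set
NormIs k G m = ∃[ Q ] (normProd k G ≈ₚ const m +ₚ Φ5 k *ₚ Q)

module Submission where

-- Work in ℤ[x]/(Φ) with Φ = Φ_{5^i}, where N_i(G) is the product of the conjugates G(x^j) over the units j
-- modulo 5^i. This norm is multiplicative, respects congruence modulo Φ and is invariant under x ↦ x², which
-- permutes the conjugates. Hence N(x) = 1, as N(x)² = N(x²) = N(x) and x is a unit, and N(1 + x) = 1 because
-- (1 + x)(1 - x) = 1 - x² and N(1 - x) can be cancelled. If N(f) = m with 5 ∤ m then 5 ∤ f(1). Since x and
-- 1 + x generate the units of (ℤ/5)[z]/(z³), z = x - 1, some x^s (1 + x)^t f is ≡ 1 modulo (5, z³); as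
-- 5 ≡ z³ r modulo Φ, it is ≡ 1 + z³ h, and it still has norm m. For i = 1, N(1 - x) = 5 and
-- (1 - x)(1 + z³ h) ≡ 1 - x + 5 E h modulo Φ₅ = z⁴ + 5 E, where E(1) = 1.

open import Defs
open import Data.Nat using (ℕ)
open import Algebra.Bundles using (CommutativeMonoid)

module Polynomial where

  open import Data.Nat as ℕ using (ℕ; zero; suc)
  import Data.Nat.Properties as ℕ
  open import Tactic.RingSolver using (solve-∀)
  open import Data.Integer as ℤ using (ℤ; +_; -[1+_])
  import Data.Integer.Properties as ℤ
  open import Data.List using ([]; _∷_)
  open import Data.Maybe as Maybe using (Maybe; just; nothing)
  open import Data.Bool using (Bool; true; _∧_; T)
  open import Data.Bool.Properties using (T-∧)
  open import Data.Product using (_,_)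
  open import Function.Bundles using (Equivalence)
  open import Relation.Nullary.Decidable using (⌊_⌋; toWitness)
  open import Relation.Binary.PropositionalEquality as ≡ using (_≡_; refl; cong; cong₂)
  open import Algebra.Bundles using (CommutativeRing)
  open import Algebra.Structures using (IsCommutativeRing)
  open import Tactic.RingSolver.Core.AlmostCommutativeRing using (AlmostCommutativeRing; fromCommutativeRing)
  import Algebra.Properties.Semiring.Exp.TCOptimised as Exp
  import Relation.Binary.Reasoning.Setoid

  -- A record, so that p and q can be inferred from a proof of p ≋ q.
  infix 4 _≋_
  record _≋_ (p q : Poly) : Set where
    constructor mk
    field coeff-≡ : p ≈ₚ q
  open _≋_ public

  ≋-refl : ∀ {p} → p ≋ p
  ≋-refl = mk λ _ → refl

  ≋-sym : ∀ {p q} → p ≋ q → q ≋ p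
  ≋-sym (mk e) = mk λ n → ≡.sym (e n)

  ≋-trans : ∀ {p q r} → p ≋ q → q ≋ r → p ≋ r
  ≋-trans (mk e) (mk f) = mk λ n → ≡.trans (e n) (f n)

  ≡⇒≋ : ∀ {p q} → p ≡ q → p ≋ q
  ≡⇒≋ refl = ≋-refl

  ∷-cong : ∀ {a b p q} → a ≡ b → p ≋ q → a ∷ p ≋ b ∷ q
  ∷-cong a≡b (mk e) = mk λ { zero → a≡b ; (suc n) → e n }

  0∷-zero : ∀ {p} → p ≋ [] → + 0 ∷ p ≋ []
  0∷-zero (mk e) = mk λ { zero → refl ; (suc n) → e n }

  coeff-+ₚ : ∀ p q n → coeff (p +ₚ q) n ≡ coeff p n ℤ.+ coeff q n
  coeff-+ₚ []      q       n       = ≡.sym (ℤ.+-identityˡ _)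
  coeff-+ₚ (a ∷ p) []      n       = ≡.sym (ℤ.+-identityʳ _)
  coeff-+ₚ (a ∷ p) (b ∷ q) zero    = refl
  coeff-+ₚ (a ∷ p) (b ∷ q) (suc n) = coeff-+ₚ p q n

  coeff-scale : ∀ c p n → coeff (scale c p) n ≡ c ℤ.* coeff p n
  coeff-scale c []      n       = ≡.sym (ℤ.*-zeroʳ c)
  coeff-scale c (a ∷ p) zero    = refl
  coeff-scale c (a ∷ p) (suc n) = coeff-scale c p n

  module _ where
    open ≡.≡-Reasoning

    +ₚ-cong : ∀ {p p′ q q′} → p ≋ p′ → q ≋ q′ → p +ₚ q ≋ p′ +ₚ q′
    +ₚ-cong {p} {p′} {q} {q′} (mk e) (mk f) = mk λ n → begin
      coeff (p +ₚ q) n           ≡⟨ coeff-+ₚ p q n ⟩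
      coeff p n ℤ.+ coeff q n    ≡⟨ cong₂ ℤ._+_ (e n) (f n) ⟩
      coeff p′ n ℤ.+ coeff q′ n  ≡⟨ coeff-+ₚ p′ q′ n ⟨
      coeff (p′ +ₚ q′) n         ∎

    +ₚ-comm : ∀ p q → p +ₚ q ≋ q +ₚ p
    +ₚ-comm p q = mk λ n → begin
      coeff (p +ₚ q) n         ≡⟨ coeff-+ₚ p q n ⟩
      coeff p n ℤ.+ coeff q n  ≡⟨ ℤ.+-comm (coeff p n) (coeff q n) ⟩
      coeff q n ℤ.+ coeff p n  ≡⟨ coeff-+ₚ q p n ⟨
      coeff (q +ₚ p) n         ∎

    +ₚ-assoc : ∀ p q r → (p +ₚ q) +ₚ r ≋ p +ₚ (q +ₚ r)
    +ₚ-assoc p q r = mk λ n → begin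
      coeff ((p +ₚ q) +ₚ r) n                  ≡⟨ coeff-+ₚ (p +ₚ q) r n ⟩
      coeff (p +ₚ q) n ℤ.+ coeff r n           ≡⟨ cong (ℤ._+ coeff r n) (coeff-+ₚ p q n) ⟩
      (coeff p n ℤ.+ coeff q n) ℤ.+ coeff r n  ≡⟨ ℤ.+-assoc (coeff p n) (coeff q n) (coeff r n) ⟩
      coeff p n ℤ.+ (coeff q n ℤ.+ coeff r n)  ≡⟨ cong (λ t → coeff p n ℤ.+ t) (coeff-+ₚ q r n) ⟨
      coeff p n ℤ.+ coeff (q +ₚ r) n           ≡⟨ coeff-+ₚ p (q +ₚ r) n ⟨
      coeff (p +ₚ (q +ₚ r)) n                  ∎

    negₚ-inverseˡ : ∀ p → negₚ p +ₚ p ≋ []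
    negₚ-inverseˡ p = mk λ n → begin
      coeff (negₚ p +ₚ p) n                ≡⟨ coeff-+ₚ (negₚ p) p n ⟩
      coeff (negₚ p) n ℤ.+ coeff p n       ≡⟨ cong (ℤ._+ coeff p n) (coeff-scale (ℤ.- + 1) p n) ⟩
      ℤ.- + 1 ℤ.* coeff p n ℤ.+ coeff p n  ≡⟨ cong (ℤ._+ coeff p n) (ℤ.-1*i≡-i (coeff p n)) ⟩
      ℤ.- coeff p n ℤ.+ coeff p n          ≡⟨ ℤ.+-inverseˡ (coeff p n) ⟩
      + 0                                  ∎

    scale-cong : ∀ c {p q} → p ≋ q → scale c p ≋ scale c q
    scale-cong c {p} {q} (mk e) = mk λ n → begin
      coeff (scale c p) n  ≡⟨ coeff-scale c p n ⟩
      c ℤ.* coeff p n      ≡⟨ cong (c ℤ.*_) (e n) ⟩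
      c ℤ.* coeff q n      ≡⟨ coeff-scale c q n ⟨
      coeff (scale c q) n  ∎

    scale-+ₚ : ∀ c p q → scale c (p +ₚ q) ≋ scale c p +ₚ scale c q
    scale-+ₚ c p q = mk λ n → begin
      coeff (scale c (p +ₚ q)) n                   ≡⟨ coeff-scale c (p +ₚ q) n ⟩
      c ℤ.* coeff (p +ₚ q) n                       ≡⟨ cong (c ℤ.*_) (coeff-+ₚ p q n) ⟩
      c ℤ.* (coeff p n ℤ.+ coeff q n)              ≡⟨ ℤ.*-distribˡ-+ c (coeff p n) (coeff q n) ⟩
      c ℤ.* coeff p n ℤ.+ c ℤ.* coeff q n          ≡⟨ cong₂ ℤ._+_ (coeff-scale c p n) (coeff-scale c q n) ⟨
      coeff (scale c p) n ℤ.+ coeff (scale c q) n  ≡⟨ coeff-+ₚ (scale c p) (scale c q) n ⟨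
      coeff (scale c p +ₚ scale c q) n             ∎

    scale-scale : ∀ a b p → scale a (scale b p) ≋ scale (a ℤ.* b) p
    scale-scale a b p = mk λ n → begin
      coeff (scale a (scale b p)) n  ≡⟨ coeff-scale a (scale b p) n ⟩
      a ℤ.* coeff (scale b p) n      ≡⟨ cong (a ℤ.*_) (coeff-scale b p n) ⟩
      a ℤ.* (b ℤ.* coeff p n)        ≡⟨ ℤ.*-assoc a b (coeff p n) ⟨
      a ℤ.* b ℤ.* coeff p n          ≡⟨ coeff-scale (a ℤ.* b) p n ⟨
      coeff (scale (a ℤ.* b) p) n    ∎

    scale-zero : ∀ p → scale (+ 0) p ≋ []
    scale-zero p = mk (coeff-scale (+ 0) p)

    scale-one : ∀ p → scale (+ 1) p ≋ p
    scale-one p = mk λ n → ≡.trans (coeff-scale (+ 1) p n) (ℤ.*-identityˡ (coeff p n))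

  +ₚ-identityʳ : ∀ p → p +ₚ [] ≋ p
  +ₚ-identityʳ []      = ≋-refl
  +ₚ-identityʳ (a ∷ p) = ≋-refl

  negₚ-inverseʳ : ∀ p → p +ₚ negₚ p ≋ []
  negₚ-inverseʳ p = ≋-trans (+ₚ-comm p (negₚ p)) (negₚ-inverseˡ p)

  +ₚ-swap : ∀ u v w x → (u +ₚ v) +ₚ (w +ₚ x) ≋ (u +ₚ w) +ₚ (v +ₚ x)
  +ₚ-swap u v w x =
    ≋-trans (+ₚ-assoc u v (w +ₚ x))
    (≋-trans (+ₚ-cong (≋-refl {u})
       (≋-trans (≋-sym (+ₚ-assoc v w x)) (≋-trans (+ₚ-cong (+ₚ-comm v w) ≋-refl) (+ₚ-assoc w v x))))
    (≋-sym (+ₚ-assoc u w (v +ₚ x))))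

  *ₚ-zeroʳ : ∀ p → p *ₚ [] ≋ []
  *ₚ-zeroʳ []      = ≋-refl
  *ₚ-zeroʳ (a ∷ p) = 0∷-zero (*ₚ-zeroʳ p)

  *ₚ-congˡ : ∀ {p p′} q → p ≋ p′ → p *ₚ q ≋ p′ *ₚ q
  *ₚ-congˡ {[]}    {[]}     q e = ≋-refl
  *ₚ-congˡ {[]}    {b ∷ p′} q (mk e) =
    ≋-sym (+ₚ-cong (≋-trans (≡⇒≋ (cong (λ c → scale c q) (≡.sym (e 0)))) (scale-zero q))
                   (0∷-zero (≋-sym (*ₚ-congˡ {[]} {p′} q (mk λ n → e (suc n))))))
  *ₚ-congˡ {a ∷ p} {[]}     q (mk e) =
    +ₚ-cong (≋-trans (≡⇒≋ (cong (λ c → scale c q) (e 0))) (scale-zero q))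
            (0∷-zero (*ₚ-congˡ {p} {[]} q (mk λ n → e (suc n))))
  *ₚ-congˡ {a ∷ p} {b ∷ p′} q (mk e) =
    +ₚ-cong (≡⇒≋ (cong (λ c → scale c q) (e 0))) (∷-cong refl (*ₚ-congˡ {p} {p′} q (mk λ n → e (suc n))))

  *ₚ-congʳ : ∀ p {q q′} → q ≋ q′ → p *ₚ q ≋ p *ₚ q′
  *ₚ-congʳ []      e = ≋-refl
  *ₚ-congʳ (a ∷ p) e = +ₚ-cong (scale-cong a e) (∷-cong refl (*ₚ-congʳ p e))

  *ₚ-cong : ∀ {p p′ q q′} → p ≋ p′ → q ≋ q′ → p *ₚ q ≋ p′ *ₚ q′
  *ₚ-cong {p′ = p′} {q = q} e f = ≋-trans (*ₚ-congˡ q e) (*ₚ-congʳ p′ f)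

  *ₚ-∷ʳ : ∀ p b q → p *ₚ (b ∷ q) ≋ scale b p +ₚ (+ 0 ∷ p *ₚ q)
  *ₚ-∷ʳ []      b q = ≋-sym (0∷-zero ≋-refl)
  *ₚ-∷ʳ (a ∷ p) b q =
    ∷-cong (≡.trans (ℤ.+-identityʳ _) (≡.trans (ℤ.*-comm a b) (≡.sym (ℤ.+-identityʳ _))))
      (≋-trans (+ₚ-cong (≋-refl {scale a q}) (*ₚ-∷ʳ p b q))
      (≋-trans (≋-sym (+ₚ-assoc (scale a q) (scale b p) _))
      (≋-trans (+ₚ-cong (+ₚ-comm (scale a q) (scale b p)) ≋-refl)
               (+ₚ-assoc (scale b p) (scale a q) _))))

  *ₚ-comm : ∀ p q → p *ₚ q ≋ q *ₚ p
  *ₚ-comm []      q = ≋-sym (*ₚ-zeroʳ q)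
  *ₚ-comm (a ∷ p) q = ≋-trans (+ₚ-cong (≋-refl {scale a q}) (∷-cong refl (*ₚ-comm p q))) (≋-sym (*ₚ-∷ʳ q a p))

  *ₚ-distribˡ : ∀ p q r → p *ₚ (q +ₚ r) ≋ p *ₚ q +ₚ p *ₚ r
  *ₚ-distribˡ []      q r = ≋-refl
  *ₚ-distribˡ (a ∷ p) q r =
    ≋-trans (+ₚ-cong (scale-+ₚ a q r) (∷-cong (≡.sym (ℤ.+-identityʳ (+ 0))) (*ₚ-distribˡ p q r)))
            (+ₚ-swap (scale a q) (scale a r) (+ 0 ∷ p *ₚ q) (+ 0 ∷ p *ₚ r))

  *ₚ-distribʳ : ∀ p q r → (q +ₚ r) *ₚ p ≋ q *ₚ p +ₚ r *ₚ p
  *ₚ-distribʳ p q r =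
    ≋-trans (*ₚ-comm (q +ₚ r) p) (≋-trans (*ₚ-distribˡ p q r) (+ₚ-cong (*ₚ-comm p q) (*ₚ-comm p r)))

  scale-*ₚ : ∀ a q r → scale a q *ₚ r ≋ scale a (q *ₚ r)
  scale-*ₚ a []      r = ≋-refl
  scale-*ₚ a (b ∷ q) r =
    ≋-trans (+ₚ-cong (≋-sym (scale-scale a b r)) (∷-cong (≡.sym (ℤ.*-zeroʳ a)) (scale-*ₚ a q r)))
            (≋-sym (scale-+ₚ a (scale b r) (+ 0 ∷ q *ₚ r)))

  *ₚ-assoc : ∀ p q r → (p *ₚ q) *ₚ r ≋ p *ₚ (q *ₚ r)
  *ₚ-assoc []      q r = ≋-refl
  *ₚ-assoc (a ∷ p) q r =
    ≋-trans (*ₚ-distribʳ r (scale a q) (+ 0 ∷ p *ₚ q))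
            (+ₚ-cong (scale-*ₚ a q r) (≋-trans (+ₚ-cong (scale-zero r) ≋-refl) (∷-cong refl (*ₚ-assoc p q r))))

  *ₚ-identityˡ : ∀ p → const (+ 1) *ₚ p ≋ p
  *ₚ-identityˡ p = ≋-trans (+ₚ-cong (scale-one p) (0∷-zero ≋-refl)) (+ₚ-identityʳ p)

  *ₚ-identityʳ : ∀ p → p *ₚ const (+ 1) ≋ p
  *ₚ-identityʳ p = ≋-trans (*ₚ-comm p _) (*ₚ-identityˡ p)

  +ₚ-*ₚ-isCommutativeRing : IsCommutativeRing _≋_ _+ₚ_ _*ₚ_ negₚ [] (const (+ 1))
  +ₚ-*ₚ-isCommutativeRing = record
    { isRing = record
      { +-isAbelianGroup = record
        { isGroup = record
          { isMonoid = record
            { isSemigroup = record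
              { isMagma = record
                { isEquivalence = record { refl = ≋-refl ; sym = ≋-sym ; trans = ≋-trans }
                ; ∙-cong = +ₚ-cong }
              ; assoc = +ₚ-assoc }
            ; identity = (λ _ → ≋-refl) , +ₚ-identityʳ }
          ; inverse = negₚ-inverseˡ , negₚ-inverseʳ
          ; ⁻¹-cong = scale-cong (ℤ.- + 1) }
        ; comm = +ₚ-comm }
      ; *-cong = *ₚ-cong
      ; *-assoc = *ₚ-assoc
      ; *-identity = *ₚ-identityˡ , *ₚ-identityʳ
      ; distrib = *ₚ-distribˡ , *ₚ-distribʳ }
    ; *-comm = *ₚ-comm }

  ℤ[x] : CommutativeRing _ _
  ℤ[x] = record { isCommutativeRing = +ₚ-*ₚ-isCommutativeRing }

  module ≋-Reasoning = Relation.Binary.Reasoning.Setoid (CommutativeRing.setoid ℤ[x])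

  -- The solver needs to recognise zero coefficients such as 1 + (-1) to normalise constants.
  ℤ[x]-solverRing : AlmostCommutativeRing _ _
  ℤ[x]-solverRing = fromCommutativeRing ℤ[x] isZero?
    where
    isZero? : ∀ p → Maybe ([] ≋ p)
    isZero? []               = just ≋-refl
    isZero? (+ zero ∷ p)     = Maybe.map (λ e → ≋-sym (0∷-zero (≋-sym e))) (isZero? p)
    isZero? (+ suc _ ∷ _)    = nothing
    isZero? (-[1+ _ ] ∷ _)   = nothing

  -- The operations as the ring solver sees them. Its _^_ agrees with Defs._^ₚ_ only up to ≋, and its _-_ has
  -- no fixity, so subtraction is redefined.
  open AlmostCommutativeRing ℤ[x]-solverRing public using (_+_; _*_; -_; 0#; 1#; _^_)

  infixl 6 _-_
  _-_ : Poly → Poly → Poly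
  p - q = p + - q

  open Exp (CommutativeRing.semiring ℤ[x]) public using (^-congˡ; ^-homo-*; ^-assocʳ)

  ^-suc : ∀ p n → p ^ suc n ≋ p * p ^ n
  ^-suc p n = ^-homo-* p 1 n

  ^-zeroˡ : ∀ n → 1# ^ n ≋ 1#
  ^-zeroˡ zero    = ≋-refl
  ^-zeroˡ (suc n) = ≋-trans (^-suc 1# n) (≋-trans (*ₚ-identityˡ _) (^-zeroˡ n))

  infix 4 _==_
  _==_ : Poly → Poly → Bool
  []      == []      = true
  []      == (b ∷ q) = ⌊ b ℤ.≟ + 0 ⌋ ∧ ([] == q)
  (a ∷ p) == []      = ⌊ a ℤ.≟ + 0 ⌋ ∧ (p == [])
  (a ∷ p) == (b ∷ q) = ⌊ a ℤ.≟ b ⌋ ∧ (p == q)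

  ==⇒≋ : ∀ p q → T (p == q) → p ≋ q
  ==⇒≋ []      []      _ = ≋-refl
  ==⇒≋ []      (b ∷ q) h with Equivalence.to T-∧ h
  ... | b≡0 , q≋[] = ≋-trans (≋-sym (0∷-zero (≋-sym (==⇒≋ [] q q≋[])))) (∷-cong (≡.sym (toWitness b≡0)) ≋-refl)
  ==⇒≋ (a ∷ p) []      h with Equivalence.to T-∧ h
  ... | a≡0 , p≋[] = ≋-trans (∷-cong (toWitness a≡0) ≋-refl) (0∷-zero (==⇒≋ p [] p≋[]))
  ==⇒≋ (a ∷ p) (b ∷ q) h with Equivalence.to T-∧ h
  ... | a≡b , p≋q  = ∷-cong (toWitness a≡b) (==⇒≋ p q p≋q)

  const-*ₗ : ∀ a p → const a * p ≋ scale a p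
  const-*ₗ a p = ≋-trans (+ₚ-cong (≋-refl {scale a p}) (0∷-zero ≋-refl)) (+ₚ-identityʳ _)

  const-* : ∀ a b → const (a ℤ.* b) ≋ const a * const b
  const-* a b = ≋-sym (const-*ₗ a (const b))

  0∷≋X* : ∀ p → + 0 ∷ p ≋ X * p
  0∷≋X* p = ≋-sym (≋-trans (+ₚ-cong (scale-zero p) ≋-refl) (∷-cong refl (*ₚ-identityˡ p)))

  ∷≋+X* : ∀ a p → a ∷ p ≋ const a + X * p
  ∷≋+X* a p = ≋-trans (∷-cong (≡.sym (ℤ.+-identityʳ a)) ≋-refl) (+ₚ-cong (≋-refl {const a}) (0∷≋X* p))

  monomial≋X^ : ∀ n → monomial n ≋ X ^ n
  monomial≋X^ zero    = ≋-refl
  monomial≋X^ (suc n) =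
    ≋-trans (0∷≋X* (monomial n)) (≋-trans (*ₚ-congʳ X (monomial≋X^ n)) (≋-sym (^-suc X n)))

  monomial-* : ∀ a t → monomial (t ℕ.* a) ≋ monomial a ^ t
  monomial-* a t = ≋-trans (monomial≋X^ (t ℕ.* a))
    (≋-trans (≡⇒≋ (cong (X ^_) (ℕ.*-comm t a)))
    (≋-trans (≋-sym (^-assocʳ X a t)) (^-congˡ t (≋-sym (monomial≋X^ a)))))

  geometric : Poly → ℕ → Poly
  geometric u zero    = 0#
  geometric u (suc n) = 1# + u * geometric u n

  [1-u]*geometric : ∀ u n → (1# - u) * geometric u n ≋ 1# - u ^ n
  [1-u]*geometric u zero    = ≋-trans (*ₚ-zeroʳ (1# - u)) (≋-sym (negₚ-inverseʳ 1#))
  [1-u]*geometric u (suc n) =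
    ≋-trans (lemma₁ u (geometric u n))
    (≋-trans (+ₚ-cong (≋-refl {1# - u}) (*ₚ-congʳ u ([1-u]*geometric u n)))
    (≋-trans (lemma₂ u (u ^ n)) (+ₚ-cong ≋-refl (scale-cong (ℤ.- + 1) (≋-sym (^-suc u n))))))
    where
    lemma₁ : ∀ u g → (1# - u) * (1# + u * g) ≋ (1# - u) + u * ((1# - u) * g)
    lemma₁ = solve-∀ ℤ[x]-solverRing
    lemma₂ : ∀ u p → (1# - u) + u * (1# - p) ≋ 1# - u * p
    lemma₂ = solve-∀ ℤ[x]-solverRing

module Congruence where

  open Polynomial
  open import Data.Nat as ℕ using (zero; suc; NonZero)
  import Data.Nat.Properties as ℕ
  open import Data.Nat.DivMod using (_%_; _/_; m≡m%n+[m/n]*n)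
  open import Data.Integer as ℤ using (+_)
  open import Data.Product using (_,_; proj₁; proj₂)
  import Relation.Binary.PropositionalEquality as ≡
  import Relation.Binary.Reasoning.Setoid
  open import Algebra.Bundles using (CommutativeRing)
  open import Algebra.Structures using (IsCommutativeRing)
  open import Tactic.RingSolver using (solve-∀)
  open CommutativeRing ℤ[x] using (isCommutativeRing)
  open IsCommutativeRing isCommutativeRing using (+-assoc; +-identity; -‿inverse; +-comm; *-assoc; *-identity; distrib; *-comm)

  infix 4 _~[_]_
  record _~[_]_ (a g b : Poly) : Set where
    constructor _,_
    field
      quotient : Poly
      ≋+multiple : a ≋ b + g * quotient

  module _ {g : Poly} where

    ≋⇒~ : ∀ {a b} → a ≋ b → a ~[ g ] b
    ≋⇒~ {a} {b} a≋b = 0# , ≋-trans a≋b (lemma g b)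
      where
      lemma : ∀ g b → b ≋ b + g * 0#
      lemma = solve-∀ ℤ[x]-solverRing

    ~-refl : ∀ {a} → a ~[ g ] a
    ~-refl = ≋⇒~ ≋-refl

    ~-sym : ∀ {a b} → a ~[ g ] b → b ~[ g ] a
    ~-sym {a} {b} (q , e) = - q , ≋-trans (lemma g b q) (+ₚ-cong (≋-sym e) ≋-refl)
      where
      lemma : ∀ g b q → b ≋ (b + g * q) + g * (- q)
      lemma = solve-∀ ℤ[x]-solverRing

    ~-trans : ∀ {a b c} → a ~[ g ] b → b ~[ g ] c → a ~[ g ] c
    ~-trans {c = c} (q , e) (q′ , e′) = q′ + q , ≋-trans e (≋-trans (+ₚ-cong e′ ≋-refl) (lemma g c q q′))
      where
      lemma : ∀ g c q q′ → (c + g * q′) + g * q ≋ c + g * (q′ + q)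
      lemma = solve-∀ ℤ[x]-solverRing

    ~-+ : ∀ {a b c d} → a ~[ g ] b → c ~[ g ] d → a + c ~[ g ] b + d
    ~-+ {b = b} {d = d} (q , e) (q′ , e′) = q + q′ , ≋-trans (+ₚ-cong e e′) (lemma g b d q q′)
      where
      lemma : ∀ g b d q q′ → (b + g * q) + (d + g * q′) ≋ (b + d) + g * (q + q′)
      lemma = solve-∀ ℤ[x]-solverRing

    ~-* : ∀ {a b c d} → a ~[ g ] b → c ~[ g ] d → a * c ~[ g ] b * d
    ~-* {b = b} {d = d} (q , e) (q′ , e′) =
      q * d + b * q′ + g * (q * q′) , ≋-trans (*ₚ-cong e e′) (lemma g b d q q′)
      where
      lemma : ∀ g b d q q′ → (b + g * q) * (d + g * q′) ≋ b * d + g * (q * d + b * q′ + g * (q * q′))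
      lemma = solve-∀ ℤ[x]-solverRing

    ~-neg : ∀ {a b} → a ~[ g ] b → - a ~[ g ] - b
    ~-neg {b = b} (q , e) = - q , ≋-trans (scale-cong (ℤ.- + 1) e) (lemma g b q)
      where
      lemma : ∀ g b q → - (b + g * q) ≋ - b + g * (- q)
      lemma = solve-∀ ℤ[x]-solverRing

    multiple~0 : ∀ a → g * a ~[ g ] 0#
    multiple~0 a = a , lemma g a
      where
      lemma : ∀ g a → g * a ≋ 0# + g * a
      lemma = solve-∀ ℤ[x]-solverRing

    modulus~0 : g ~[ g ] 0#
    modulus~0 = ~-trans (≋⇒~ (≋-sym (*ₚ-identityʳ g))) (multiple~0 1#)

    ~-^ : ∀ {a b} n → a ~[ g ] b → a ^ n ~[ g ] b ^ n
    ~-^ zero    a~b = ~-refl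
    ~-^ (suc n) a~b = ~-trans (≋⇒~ (^-suc _ n)) (~-trans (~-* a~b (~-^ n a~b)) (≋⇒~ (≋-sym (^-suc _ n))))

    quotient-isCommutativeRing : IsCommutativeRing _~[ g ]_ _+_ _*_ -_ 0# 1#
    quotient-isCommutativeRing = record
      { isRing = record
        { +-isAbelianGroup = record
          { isGroup = record
            { isMonoid = record
              { isSemigroup = record
                { isMagma = record
                  { isEquivalence = record { refl = ~-refl ; sym = ~-sym ; trans = ~-trans }
                  ; ∙-cong = ~-+ }
                ; assoc = λ x y z → ≋⇒~ (+-assoc x y z) }
              ; identity = (λ x → ≋⇒~ (+-identity .proj₁ x)) , (λ x → ≋⇒~ (+-identity .proj₂ x)) }
            ; inverse = (λ x → ≋⇒~ (-‿inverse .proj₁ x)) , (λ x → ≋⇒~ (-‿inverse .proj₂ x))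
            ; ⁻¹-cong = ~-neg }
          ; comm = λ x y → ≋⇒~ (+-comm x y) }
        ; *-cong = ~-*
        ; *-assoc = λ x y z → ≋⇒~ (*-assoc x y z)
        ; *-identity = (λ x → ≋⇒~ (*-identity .proj₁ x)) , (λ x → ≋⇒~ (*-identity .proj₂ x))
        ; distrib = (λ x y z → ≋⇒~ (distrib .proj₁ x y z)) , (λ x y z → ≋⇒~ (distrib .proj₂ x y z)) }
      ; *-comm = λ x y → ≋⇒~ (*-comm x y) }

  ℤ[x]/ : Poly → CommutativeRing _ _
  ℤ[x]/ g = record { isCommutativeRing = quotient-isCommutativeRing {g} }

  module ~-Reasoning (g : Poly) = Relation.Binary.Reasoning.Setoid (CommutativeRing.setoid (ℤ[x]/ g))

  ~-*ˡ : ∀ {g} a {b c} → b ~[ g ] c → a * b ~[ g ] a * c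
  ~-*ˡ a b~c = ~-* (~-refl {a = a}) b~c

  ~-*ʳ : ∀ {g} c {a b} → a ~[ g ] b → a * c ~[ g ] b * c
  ~-*ʳ c a~b = ~-* a~b (~-refl {a = c})

  ~-+ˡ : ∀ {g} a {b c} → b ~[ g ] c → a + b ~[ g ] a + c
  ~-+ˡ a b~c = ~-+ (~-refl {a = a}) b~c

  ^-%-~ : ∀ {g u} n .{{_ : NonZero n}} → u ^ n ~[ g ] 1# → ∀ j → u ^ j ~[ g ] u ^ (j % n)
  ^-%-~ {g} {u} n uⁿ~1 j = begin
    u ^ j                              ≡⟨ ≡.cong (u ^_) (m≡m%n+[m/n]*n j n) ⟩
    u ^ (j % n ℕ.+ j / n ℕ.* n)        ≈⟨ ≋⇒~ (^-homo-* u (j % n) (j / n ℕ.* n)) ⟩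
    u ^ (j % n) * u ^ (j / n ℕ.* n)    ≡⟨ ≡.cong (λ e → u ^ (j % n) * u ^ e) (ℕ.*-comm (j / n) n) ⟩
    u ^ (j % n) * u ^ (n ℕ.* (j / n))  ≈⟨ ~-*ˡ (u ^ (j % n)) (≋⇒~ (≋-sym (^-assocʳ u n (j / n)))) ⟩
    u ^ (j % n) * (u ^ n) ^ (j / n)    ≈⟨ ~-*ˡ (u ^ (j % n)) (~-^ (j / n) uⁿ~1) ⟩
    u ^ (j % n) * 1# ^ (j / n)         ≈⟨ ≋⇒~ (*ₚ-congʳ (u ^ (j % n)) (^-zeroˡ (j / n))) ⟩
    u ^ (j % n) * 1#                   ≈⟨ ≋⇒~ (*ₚ-identityʳ (u ^ (j % n))) ⟩
    u ^ (j % n)                        ∎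
    where open ~-Reasoning g

module ListProduct {c ℓ} (M : CommutativeMonoid c ℓ) where

  open CommutativeMonoid M
  open import Data.List using (List; []; _∷_; foldr; map)
  open import Data.List.Properties using (foldr-map)
  open import Data.List.Membership.Propositional using (_∈_)
  open import Data.List.Relation.Unary.Any using (here; there)
  open import Data.List.Relation.Binary.Permutation.Propositional using (_↭_; ↭⇒↭ₛ′)
  import Data.List.Relation.Binary.Permutation.Propositional.Properties as ↭
  open import Data.List.Relation.Binary.Permutation.Setoid.Properties setoid using (foldr-commMonoid)
  import Relation.Binary.PropositionalEquality as ≡
  open import Relation.Binary.Reasoning.Setoid setoid

  ∏ : {A : Set} → (A → Carrier) → List A → Carrier
  ∏ f = foldr (λ x acc → f x ∙ acc) ε

  module _ {A : Set} where

    ∏-cong : ∀ {f g : A → Carrier} xs → (∀ {x} → x ∈ xs → f x ≈ g x) → ∏ f xs ≈ ∏ g xs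
    ∏-cong []       f≈g = refl
    ∏-cong (x ∷ xs) f≈g = ∙-cong (f≈g (here ≡.refl)) (∏-cong xs (λ x∈xs → f≈g (there x∈xs)))

    ∏-ε : ∀ (f : A → Carrier) xs → (∀ x → f x ≈ ε) → ∏ f xs ≈ ε
    ∏-ε f []       f≈ε = refl
    ∏-ε f (x ∷ xs) f≈ε = trans (∙-cong (f≈ε x) (∏-ε f xs f≈ε)) (identityˡ ε)

    ∏-distrib : ∀ (f g : A → Carrier) xs → ∏ (λ x → f x ∙ g x) xs ≈ ∏ f xs ∙ ∏ g xs
    ∏-distrib f g []       = sym (identityˡ ε)
    ∏-distrib f g (x ∷ xs) = begin
      (f x ∙ g x) ∙ ∏ (λ x → f x ∙ g x) xs  ≈⟨ ∙-congˡ (∏-distrib f g xs) ⟩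
      (f x ∙ g x) ∙ (∏ f xs ∙ ∏ g xs)       ≈⟨ interchange (f x) (g x) (∏ f xs) (∏ g xs) ⟩
      (f x ∙ ∏ f xs) ∙ (g x ∙ ∏ g xs)       ∎
      where open import Algebra.Properties.CommutativeSemigroup commutativeSemigroup using (interchange)

    ∏-↭ : ∀ (f : A → Carrier) {xs ys} → xs ↭ ys → ∏ f xs ≈ ∏ f ys
    ∏-↭ f {xs} {ys} xs↭ys = begin
      ∏ f xs                  ≡⟨ foldr-map _∙_ f ε xs ⟨
      foldr _∙_ ε (map f xs)  ≈⟨ foldr-commMonoid isCommutativeMonoid (↭⇒↭ₛ′ isEquivalence (↭.map⁺ f xs↭ys)) ⟩
      foldr _∙_ ε (map f ys)  ≡⟨ foldr-map _∙_ f ε ys ⟩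
      ∏ f ys                  ∎

module Composition where

  open Polynomial
  open Congruence
  open import Data.Nat as ℕ using (ℕ; zero; suc)
  import Data.Nat.Properties as ℕ
  open import Data.Integer as ℤ using (ℤ; +_)
  open import Data.List using ([]; _∷_)
  open import Data.Product using (_,_)
  open import Relation.Binary.PropositionalEquality using (cong)
  open import Tactic.RingSolver using (solve-∀)

  compose-zero : ∀ {p} q → p ≋ [] → compose p q ≋ []
  compose-zero {[]}    q e      = ≋-refl
  compose-zero {a ∷ p} q (mk e) =
    ≋-trans (+ₚ-cong (≋-trans (≡⇒≋ (cong const (e 0))) (0∷-zero ≋-refl))
                     (*ₚ-congʳ q (compose-zero {p} q (mk λ n → e (suc n)))))
            (*ₚ-zeroʳ q)

  compose-congˡ : ∀ {p p′} q → p ≋ p′ → compose p q ≋ compose p′ q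
  compose-congˡ {[]}    {p′}     q e      = ≋-sym (compose-zero q (≋-sym e))
  compose-congˡ {a ∷ p} {[]}     q e      = compose-zero q e
  compose-congˡ {a ∷ p} {b ∷ p′} q (mk e) =
    +ₚ-cong (≡⇒≋ (cong const (e 0))) (*ₚ-congʳ q (compose-congˡ {p} {p′} q (mk λ n → e (suc n))))

  compose-congʳ : ∀ p {q q′} → q ≋ q′ → compose p q ≋ compose p q′
  compose-congʳ []      e = ≋-refl
  compose-congʳ (a ∷ p) e = +ₚ-cong ≋-refl (*ₚ-cong e (compose-congʳ p e))

  compose-const : ∀ a q → compose (const a) q ≋ const a
  compose-const a q = ≋-trans (+ₚ-cong ≋-refl (*ₚ-zeroʳ q)) (+ₚ-identityʳ _)

  compose-+ : ∀ p r q → compose (p +ₚ r) q ≋ compose p q + compose r q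
  compose-+ []      r       q = ≋-refl
  compose-+ (a ∷ p) []      q = ≋-sym (+ₚ-identityʳ _)
  compose-+ (a ∷ p) (b ∷ r) q =
    ≋-trans (+ₚ-cong ≋-refl (*ₚ-congʳ q (compose-+ p r q))) (lemma (const a) (const b) q (compose p q) (compose r q))
    where
    lemma : ∀ A B q P R → (A + B) + q * (P + R) ≋ (A + q * P) + (B + q * R)
    lemma = solve-∀ ℤ[x]-solverRing

  compose-scale : ∀ c p q → compose (scale c p) q ≋ const c * compose p q
  compose-scale c []      q = ≋-sym (*ₚ-zeroʳ (const c))
  compose-scale c (a ∷ p) q =
    ≋-trans (+ₚ-cong (const-* c a) (*ₚ-congʳ q (compose-scale c p q))) (lemma (const c) (const a) q (compose p q))
    where
    lemma : ∀ C A q P → C * A + q * (C * P) ≋ C * (A + q * P)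
    lemma = solve-∀ ℤ[x]-solverRing

  compose-* : ∀ p r q → compose (p * r) q ≋ compose p q * compose r q
  compose-* []      r q = ≋-refl
  compose-* (a ∷ p) r q =
    ≋-trans (compose-+ (scale a r) (+ 0 ∷ p * r) q)
    (≋-trans (+ₚ-cong (compose-scale a r q) (+ₚ-cong (0∷-zero ≋-refl) (*ₚ-congʳ q (compose-* p r q))))
             (lemma (const a) q (compose p q) (compose r q)))
    where
    lemma : ∀ A q P R → A * R + (0# + q * (P * R)) ≋ (A + q * P) * R
    lemma = solve-∀ ℤ[x]-solverRing

  compose-neg : ∀ p q → compose (- p) q ≋ - compose p q
  compose-neg p q = ≋-trans (compose-scale (ℤ.- + 1) p q) (const-*ₗ (ℤ.- + 1) _)

  compose-X : ∀ q → compose X q ≋ q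
  compose-X q = ≋-trans (+ₚ-cong (0∷-zero ≋-refl) (≋-trans (*ₚ-congʳ q (compose-const (+ 1) q)) (*ₚ-identityʳ q))) ≋-refl

  compose-^ : ∀ p n q → compose (p ^ n) q ≋ compose p q ^ n
  compose-^ p zero    q = compose-const (+ 1) q
  compose-^ p (suc n) q =
    ≋-trans (compose-congˡ q (^-suc p n)) (≋-trans (compose-* p (p ^ n) q)
    (≋-trans (*ₚ-congʳ (compose p q) (compose-^ p n q)) (≋-sym (^-suc (compose p q) n))))

  compose-assoc : ∀ p r q → compose (compose p r) q ≋ compose p (compose r q)
  compose-assoc []      r q = ≋-refl
  compose-assoc (a ∷ p) r q =
    ≋-trans (compose-+ (const a) (r * compose p r) q)
    (+ₚ-cong (compose-const a q)
             (≋-trans (compose-* r (compose p r) q) (*ₚ-congʳ (compose r q) (compose-assoc p r q))))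

  compose-monomial : ∀ a q → compose (monomial a) q ≋ q ^ a
  compose-monomial a q =
    ≋-trans (compose-congˡ q (monomial≋X^ a)) (≋-trans (compose-^ X a q) (^-congˡ a (compose-X q)))

  compose-monomial-monomial : ∀ a b → compose (monomial a) (monomial b) ≋ monomial (b ℕ.* a)
  compose-monomial-monomial a b =
    ≋-trans (compose-monomial a (monomial b)) (≋-trans (≋-sym (monomial-* b a)) (≡⇒≋ (cong monomial (ℕ.*-comm a b))))

  compose-~ʳ : ∀ {g} p {q q′} → q ~[ g ] q′ → compose p q ~[ g ] compose p q′
  compose-~ʳ []      e = ~-refl
  compose-~ʳ (a ∷ p) e = ~-+ ~-refl (~-* e (compose-~ʳ p e))

  compose-~ˡ : ∀ {g p p′} q → compose g q ~[ g ] 0# → p ~[ g ] p′ → compose p q ~[ g ] compose p′ q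
  compose-~ˡ {g} {p} {p′} q g[q]~0 (r , p≋p′+gr) =
    ~-trans (≋⇒~ (≋-trans (compose-congˡ q p≋p′+gr) (compose-+ p′ (g * r) q)))
    (~-trans (~-+ ~-refl (~-trans (≋⇒~ (compose-* g r q)) (~-* g[q]~0 ~-refl)))
             (≋⇒~ (lemma (compose p′ q) (compose r q))))
    where
    lemma : ∀ a b → a + 0# * b ≋ a
    lemma = solve-∀ ℤ[x]-solverRing

module Evaluation where

  open Polynomial
  open Composition
  open import Data.Nat using (zero; suc)
  open import Data.Integer as ℤ using (ℤ; +_)
  import Data.Integer.Properties as ℤ
  open import Data.List using ([]; _∷_)
  open import Data.Product using (_,_; ∃; proj₁; proj₂)
  open import Relation.Binary.PropositionalEquality as ≡ using (_≡_; _≢_; refl; cong)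
  open import Relation.Nullary using (contradiction)
  open import Data.Sum using ([_,_]′)
  open import Function using (id; flip)
  open Congruence
  open import Tactic.RingSolver using (solve-∀)

  compose-const≋eval : ∀ p t → compose p (const t) ≋ const (eval p t)
  compose-const≋eval []      t = ≋-sym (0∷-zero ≋-refl)
  compose-const≋eval (a ∷ p) t =
    +ₚ-cong (≋-refl {const a}) (≋-trans (*ₚ-congʳ (const t) (compose-const≋eval p t)) (≋-sym (const-* t (eval p t))))

  const-injective : ∀ {a b} → const a ≋ const b → a ≡ b
  const-injective (mk e) = e 0

  eval-cong : ∀ {p q} t → p ≋ q → eval p t ≡ eval q t
  eval-cong {p} {q} t p≋q = const-injective
    (≋-trans (≋-sym (compose-const≋eval p t)) (≋-trans (compose-congˡ (const t) p≋q) (compose-const≋eval q t)))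

  eval-+ : ∀ p q t → eval (p + q) t ≡ eval p t ℤ.+ eval q t
  eval-+ p q t = const-injective
    (≋-trans (≋-sym (compose-const≋eval (p + q) t))
    (≋-trans (compose-+ p q (const t)) (+ₚ-cong (compose-const≋eval p t) (compose-const≋eval q t))))

  eval-* : ∀ p q t → eval (p * q) t ≡ eval p t ℤ.* eval q t
  eval-* p q t = const-injective
    (≋-trans (≋-sym (compose-const≋eval (p * q) t))
    (≋-trans (compose-* p q (const t))
    (≋-trans (*ₚ-cong (compose-const≋eval p t) (compose-const≋eval q t)) (≋-sym (const-* (eval p t) (eval q t))))))

  eval-compose : ∀ p q t → eval (compose p q) t ≡ eval p (eval q t)
  eval-compose p q t = const-injective
    (≋-trans (≋-sym (compose-const≋eval (compose p q) t))
    (≋-trans (compose-assoc p q (const t))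
    (≋-trans (compose-congʳ p (compose-const≋eval q t)) (compose-const≋eval p (eval q t)))))

  eval-const : ∀ a t → eval (const a) t ≡ a
  eval-const a t = ≡.trans (cong (λ e → a ℤ.+ e) (ℤ.*-zeroʳ t)) (ℤ.+-identityʳ a)

  eval-monomial-1 : ∀ n → eval (monomial n) (+ 1) ≡ + 1
  eval-monomial-1 zero    = refl
  eval-monomial-1 (suc n) = ≡.trans (ℤ.+-identityˡ _) (≡.trans (ℤ.*-identityˡ (eval (monomial n) (+ 1))) (eval-monomial-1 n))

  ≋eval+[x-1]* : ∀ p → ∃ λ q → p ≋ const (eval p (+ 1)) + (X - 1#) * q
  ≋eval+[x-1]* []      = [] , ≋-sym (+ₚ-cong (0∷-zero ≋-refl) (*ₚ-zeroʳ (X - 1#)))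
  ≋eval+[x-1]* (a ∷ p) with ≋eval+[x-1]* p
  ... | q , p≋ = p[1] + X * q , (begin
    a ∷ p                                                   ≈⟨ ∷≋+X* a p ⟩
    const a + X * p                                         ≈⟨ +ₚ-cong (≋-refl {const a}) (*ₚ-congʳ X p≋) ⟩
    const a + X * (p[1] + (X - 1#) * q)                     ≈⟨ lemma X (const a) p[1] q ⟩
    (const a + p[1]) + (X - 1#) * (p[1] + X * q)            ≈⟨ +ₚ-cong a+p[1]≋ (≋-refl {(X - 1#) * (p[1] + X * q)}) ⟩
    const (eval (a ∷ p) (+ 1)) + (X - 1#) * (p[1] + X * q)  ∎)
    where
    open ≋-Reasoning
    p[1] = const (eval p (+ 1))
    a+p[1]≋ : const a + p[1] ≋ const (eval (a ∷ p) (+ 1))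
    a+p[1]≋ = ≡⇒≋ (cong (λ e → const (a ℤ.+ e)) (≡.sym (ℤ.*-identityˡ (eval p (+ 1)))))
    lemma : ∀ x A E q → A + x * (E + (x - 1#) * q) ≋ (A + E) + (x - 1#) * (E + x * q)
    lemma = solve-∀ ℤ[x]-solverRing

  coeff₀-* : ∀ p q → coeff (p * q) 0 ≡ coeff p 0 ℤ.* coeff q 0
  coeff₀-* []      q = refl
  coeff₀-* (a ∷ p) q = ≡.trans (coeff-+ₚ (scale a q) (+ 0 ∷ p * q) 0) (≡.trans (ℤ.+-identityʳ _) (coeff-scale a q 0))

  -- Comparing coefficients from the bottom up: the lowest one of p is the lowest one of (1 - x) p.
  [1-x]*-cancel : ∀ p → (1# - X) * p ≋ [] → p ≋ []
  [1-x]*-cancel []      _   = ≋-refl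
  [1-x]*-cancel (a ∷ p) [1-x]a∷p≋0 = ≋-trans (∷-cong a≡0 ≋-refl) (0∷-zero ([1-x]*-cancel p [1-x]p≋0))
    where
    a≡0 : a ≡ + 0
    a≡0 = ≡.trans (≡.sym (ℤ.*-identityˡ a)) (≡.trans (≡.sym (coeff₀-* (1# - X) (a ∷ p))) (coeff-≡ [1-x]a∷p≋0 0))
    lemma : ∀ x p → (1# - x) * (x * p) ≋ x * ((1# - x) * p)
    lemma = solve-∀ ℤ[x]-solverRing
    0∷[1-x]p≋0 : + 0 ∷ (1# - X) * p ≋ []
    0∷[1-x]p≋0 = ≋-trans (0∷≋X* _) (≋-trans (≋-sym (lemma X p))
      (≋-trans (*ₚ-congʳ (1# - X) (≋-trans (≋-sym (0∷≋X* p)) (∷-cong (≡.sym a≡0) ≋-refl))) [1-x]a∷p≋0))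
    [1-x]p≋0 : (1# - X) * p ≋ []
    [1-x]p≋0 = mk λ n → coeff-≡ 0∷[1-x]p≋0 (suc n)

  -- Evaluating (1 - x) S = g Q at x = 1 shows Q = (x - 1) Q′, so (1 - x)(S + g Q′) = 0.
  [1-x]*-cancel-mod : ∀ {g} → eval g (+ 1) ≢ + 0 → ∀ S → (1# - X) * S ~[ g ] 0# → S ~[ g ] 0#
  [1-x]*-cancel-mod {g} g[1]≢0 S (Q , [1-x]S≋gQ) =
    - Q′ , ≋-trans (lemma₁ S g Q′) (+ₚ-cong ([1-x]*-cancel (S + g * Q′) [1-x][S+gQ′]≋0) ≋-refl)
    where
    g[1]*Q[1]≡0 : eval g (+ 1) ℤ.* eval Q (+ 1) ≡ + 0
    g[1]*Q[1]≡0 = ≡.sym (begin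
      + 0                            ≡⟨ ℤ.*-zeroˡ (eval S (+ 1)) ⟨
      + 0 ℤ.* eval S (+ 1)           ≡⟨ eval-* (1# - X) S (+ 1) ⟨
      eval ((1# - X) * S) (+ 1)      ≡⟨ eval-cong (+ 1) [1-x]S≋gQ ⟩
      eval (g * Q) (+ 1)             ≡⟨ eval-* g Q (+ 1) ⟩
      eval g (+ 1) ℤ.* eval Q (+ 1)  ∎)
      where open ≡.≡-Reasoning
    Q[1]≡0 : eval Q (+ 1) ≡ + 0
    Q[1]≡0 = [ flip contradiction g[1]≢0 , id ]′ (ℤ.i*j≡0⇒i≡0∨j≡0 (eval g (+ 1)) g[1]*Q[1]≡0)
    Q′ : Poly
    Q′ = ≋eval+[x-1]* Q .proj₁
    Q≋[x-1]Q′ : Q ≋ (X - 1#) * Q′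
    Q≋[x-1]Q′ = ≋-trans (≋eval+[x-1]* Q .proj₂) (+ₚ-cong (≋-trans (≡⇒≋ (cong const Q[1]≡0)) (0∷-zero ≋-refl)) ≋-refl)
    lemma₁ : ∀ S g Q′ → S ≋ (S + g * Q′) + g * (- Q′)
    lemma₁ = solve-∀ ℤ[x]-solverRing
    lemma₂ : ∀ x S g Q′ → (1# - x) * (S + g * Q′) ≋ (1# - x) * S - g * ((x - 1#) * Q′)
    lemma₂ = solve-∀ ℤ[x]-solverRing
    [1-x][S+gQ′]≋0 : (1# - X) * (S + g * Q′) ≋ []
    [1-x][S+gQ′]≋0 = ≋-trans (lemma₂ X S g Q′)
          (≋-trans (+ₚ-cong [1-x]S≋gQ (scale-cong (ℤ.- + 1) (*ₚ-congʳ g (≋-sym Q≋[x-1]Q′)))) (negₚ-inverseʳ (g * Q)))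

module CyclotomicFive where

  open Polynomial
  open Congruence
  open Composition
  open import Data.Integer using (+_)
  open import Data.Nat using (suc; _<_; s≤s)
  open import Data.Product using (_,_; ∃; ∃₂)
  open import Tactic.RingSolver using (solve-∀)

  Φ₅ : Poly → Poly
  Φ₅ u = 1# + u + u ^ 2 + u ^ 3 + u ^ 4

  Φ₅-cong : ∀ {u v} → u ≋ v → Φ₅ u ≋ Φ₅ v
  Φ₅-cong u≋v = +ₚ-cong (+ₚ-cong (+ₚ-cong (+ₚ-cong ≋-refl u≋v) (^-congˡ 2 u≋v)) (^-congˡ 3 u≋v)) (^-congˡ 4 u≋v)

  Φ₅-~ : ∀ {g u v} → u ~[ g ] v → Φ₅ u ~[ g ] Φ₅ v
  Φ₅-~ u~v = ~-+ (~-+ (~-+ (~-+ ~-refl u~v) (~-^ 2 u~v)) (~-^ 3 u~v)) (~-^ 4 u~v)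

  compose-Φ₅ : ∀ u q → compose (Φ₅ u) q ≋ Φ₅ (compose u q)
  compose-Φ₅ u q =
    ≋-trans (compose-+ (1# + u + u ^ 2 + u ^ 3) (u ^ 4) q) (+ₚ-cong
    (≋-trans (compose-+ (1# + u + u ^ 2) (u ^ 3) q) (+ₚ-cong
    (≋-trans (compose-+ (1# + u) (u ^ 2) q) (+ₚ-cong
    (≋-trans (compose-+ 1# u q) (+ₚ-cong (compose-const (+ 1) q) ≋-refl))
    (compose-^ u 2 q)))
    (compose-^ u 3 q)))
    (compose-^ u 4 q))

  [u-1]*Φ₅ : ∀ u → (u - 1#) * Φ₅ u ≋ u ^ 5 - 1#
  [u-1]*Φ₅ = lemma
    where
    lemma : ∀ u → (u - 1#) * (1# + u + u ^ 2 + u ^ 3 + u ^ 4) ≋ u ^ 5 - 1#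
    lemma = solve-∀ ℤ[x]-solverRing

  -- For 5 ∤ r, Φ₅(u^r) = (u^{5r} - 1)/(u^r - 1) is divisible by Φ₅(u) = (u^5 - 1)/(u - 1).
  Φ₅∣Φ₅[^r] : ∀ r → 0 < r → r < 5 → ∀ u → ∃ λ q → Φ₅ (u ^ r) ≋ Φ₅ u * q
  Φ₅∣Φ₅[^r] 1 _ _ u = 1# , ≋-sym (*ₚ-identityʳ (Φ₅ u))
  Φ₅∣Φ₅[^r] 2 _ _ u = 1# + (u - 1#) * (u + u ^ 3) , lemma u
    where
    lemma : ∀ u → 1# + u ^ 2 + (u ^ 2) ^ 2 + (u ^ 2) ^ 3 + (u ^ 2) ^ 4
                  ≋ (1# + u + u ^ 2 + u ^ 3 + u ^ 4) * (1# + (u - 1#) * (u + u ^ 3))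
    lemma = solve-∀ ℤ[x]-solverRing
  Φ₅∣Φ₅[^r] 3 _ _ u = 1# + (u - 1#) * (u + u ^ 2 + u ^ 4 + u ^ 7) , lemma u
    where
    lemma : ∀ u → 1# + u ^ 3 + (u ^ 3) ^ 2 + (u ^ 3) ^ 3 + (u ^ 3) ^ 4
                  ≋ (1# + u + u ^ 2 + u ^ 3 + u ^ 4) * (1# + (u - 1#) * (u + u ^ 2 + u ^ 4 + u ^ 7))
    lemma = solve-∀ ℤ[x]-solverRing
  Φ₅∣Φ₅[^r] 4 _ _ u = 1# + (u - 1#) * (u + u ^ 2 + u ^ 3 + u ^ 6 + u ^ 7 + u ^ 11) , lemma u
    where
    lemma : ∀ u → 1# + u ^ 4 + (u ^ 4) ^ 2 + (u ^ 4) ^ 3 + (u ^ 4) ^ 4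
                  ≋ (1# + u + u ^ 2 + u ^ 3 + u ^ 4) * (1# + (u - 1#) * (u + u ^ 2 + u ^ 3 + u ^ 6 + u ^ 7 + u ^ 11))
    lemma = solve-∀ ℤ[x]-solverRing
  Φ₅∣Φ₅[^r] (suc (suc (suc (suc (suc _))))) _ (s≤s (s≤s (s≤s (s≤s (s≤s ())))))

  -- Φ₅(1 + w) = 5 (1 + w D) + w⁴ with D = 2 + 2w + w², and (1 + w D)(1 - w D + w² D²) = 1 + w³ D³.
  5≋[u-1]³*+*Φ₅ : ∀ u → ∃₂ λ r s → const (+ 5) ≋ (u - 1#) ^ 3 * r + s * Φ₅ u
  5≋[u-1]³*+*Φ₅ u = - (w * K) - c5 * D ^ 3 , K , (begin
    c5                                                                  ≈⟨ lemma₁ w D ⟩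
    K * (c5 * (1# + w * D) + w ^ 4) + w ^ 3 * (- (w * K) - c5 * D ^ 3)  ≈⟨ +ₚ-cong (*ₚ-congʳ K (≋-sym (lemma₂ u))) ≋-refl ⟩
    K * Φ₅ u + w ^ 3 * (- (w * K) - c5 * D ^ 3)                         ≈⟨ +ₚ-comm (K * Φ₅ u) _ ⟩
    w ^ 3 * (- (w * K) - c5 * D ^ 3) + K * Φ₅ u                         ∎)
    where
    open ≋-Reasoning
    c2 c5 w D K : Poly
    c2 = const (+ 2)
    c5 = const (+ 5)
    w = u - 1#
    D = c2 + c2 * w + w ^ 2
    K = 1# - w * D + (w * D) ^ 2
    lemma₁ : ∀ w D → c5 ≋ (1# - w * D + (w * D) ^ 2) * (c5 * (1# + w * D) + w ^ 4)
                          + w ^ 3 * (- (w * (1# - w * D + (w * D) ^ 2)) - c5 * D ^ 3)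
    lemma₁ = solve-∀ ℤ[x]-solverRing
    lemma₂ : ∀ u → 1# + u + u ^ 2 + u ^ 3 + u ^ 4
                   ≋ c5 * (1# + (u - 1#) * (c2 + c2 * (u - 1#) + (u - 1#) ^ 2)) + (u - 1#) ^ 4
    lemma₂ = solve-∀ ℤ[x]-solverRing

module Coprimality where

  open import Data.Nat as ℕ using (ℕ; zero; suc; _+_; _*_; _^_; _<_; NonZero)
  import Data.Nat.Properties as ℕ
  open import Data.Nat.DivMod using (_%_; [m+kn]%n≡m%n; m<n⇒m%n≡m)
  open import Data.Nat.Divisibility using (_∣_; ∣1⇒≡1; ∣-trans)
  open import Data.Nat.Coprimality using (Coprime; coprime-divisor)
  open import Data.Nat.GCD using (module Bézout)
  open import Data.Nat.Primality using (Prime; prime?; prime⇒irreducible)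
  open import Data.Product using (_,_; ∃)
  open import Data.Sum using (inj₁; inj₂)
  open import Relation.Binary.PropositionalEquality as ≡ using (_≡_; refl; cong)
  open import Relation.Nullary using (¬_; contradiction)
  open import Relation.Nullary.Decidable using (from-yes)

  5-prime : Prime 5
  5-prime = from-yes (prime? 5)

  5∤⇒coprime-5 : ∀ {j} → ¬ 5 ∣ j → Coprime j 5
  5∤⇒coprime-5 5∤j (e∣j , e∣5) with prime⇒irreducible 5-prime e∣5
  ... | inj₁ e≡1  = e≡1
  ... | inj₂ refl = contradiction e∣j 5∤j

  5∤⇒coprime-5^ : ∀ {j} → ¬ 5 ∣ j → ∀ n → Coprime j (5 ^ n)
  5∤⇒coprime-5^ 5∤j zero    (_ , d∣1) = ∣1⇒≡1 d∣1
  5∤⇒coprime-5^ 5∤j (suc n) (d∣j , d∣5*5^n) =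
    5∤⇒coprime-5^ 5∤j n (d∣j , coprime-divisor (λ (e∣d , e∣5) → 5∤⇒coprime-5 5∤j (∣-trans e∣d d∣j , e∣5)) d∣5*5^n)

  -- A Bézout identity x j ∓ y n = ±1 gives the inverse x, resp. x (n - 1), of j modulo n.
  Bézout⇒inverse : ∀ n .{{_ : NonZero n}} j → 1 < n → Bézout.Identity 1 j n → ∃ λ j′ → (j * j′) % n ≡ 1
  Bézout⇒inverse (suc t) j 1<n (Bézout.+- x y 1+yn≡xj) = x , (begin
    (j * x) % suc t          ≡⟨ cong (_% suc t) (≡.trans (ℕ.*-comm j x) (≡.sym 1+yn≡xj)) ⟩
    (1 + y * suc t) % suc t  ≡⟨ [m+kn]%n≡m%n 1 y (suc t) ⟩
    1 % suc t                ≡⟨ m<n⇒m%n≡m 1<n ⟩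
    1                        ∎)
    where open ≡.≡-Reasoning
  Bézout⇒inverse (suc t) j 1<n (Bézout.-+ x y 1+xj≡yn) = x * t , (begin
    (j * (x * t)) % suc t              ≡⟨ [m+kn]%n≡m%n (j * (x * t)) 1 (suc t) ⟨
    (j * (x * t) + 1 * suc t) % suc t  ≡⟨ cong (_% suc t) (lemma₁ j x t) ⟩
    ((1 + x * j) * t + 1) % suc t      ≡⟨ cong (λ e → (e * t + 1) % suc t) 1+xj≡yn ⟩
    (y * suc t * t + 1) % suc t        ≡⟨ cong (_% suc t) (lemma₂ y t) ⟩
    (1 + y * t * suc t) % suc t        ≡⟨ [m+kn]%n≡m%n 1 (y * t) (suc t) ⟩
    1 % suc t                          ≡⟨ m<n⇒m%n≡m 1<n ⟩
    1                                  ∎)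
    where
    open ≡.≡-Reasoning
    open import Data.Nat.Tactic.RingSolver using (solve-∀)
    lemma₁ : ∀ j x t → j * (x * t) + 1 * suc t ≡ (1 + x * j) * t + 1
    lemma₁ = solve-∀
    lemma₂ : ∀ y t → y * suc t * t + 1 ≡ 1 + y * t * suc t
    lemma₂ = solve-∀

module UnitsModulo (k : ℕ) where

  open Coprimality
  open import Data.Nat as ℕ using (ℕ; zero; suc; _*_; _^_; _<_; NonZero; s≤s; z≤n)
  import Data.Nat.Properties as ℕ
  open import Data.Nat.DivMod
  open import Data.Nat.Divisibility
  open import Data.Nat.Coprimality using (coprime-Bézout)
  open import Data.Nat.Primality using (euclidsLemma)
  open import Data.List using (List; map; upTo)
  open import Data.List.Properties using (map-id-local; map-∘)
  open import Data.List.Membership.Propositional using (_∈_)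
  open import Data.List.Membership.Propositional.Properties using (∈-filter⁻; ∈-filter⁺; ∈-map⁻; ∈-map⁺; ∈-upTo⁻; ∈-upTo⁺)
  open import Data.List.Membership.Propositional.Properties.WithK using (unique∧set⇒bag)
  open import Data.List.Relation.Binary.BagAndSetEquality using (∼bag⇒↭)
  open import Data.List.Relation.Binary.Permutation.Propositional using (_↭_)
  open import Data.List.Relation.Unary.Unique.Propositional using (Unique)
  import Data.List.Relation.Unary.Unique.Propositional.Properties as Unique
  import Data.List.Relation.Unary.All as All
  open import Data.Product using (_,_; ∃; _×_; proj₁; proj₂)
  open import Data.Sum using (inj₁; inj₂; [_,_]′)
  open import Function.Bundles using (mk⇔)
  open import Relation.Binary.PropositionalEquality as ≡ using (_≡_; refl; cong)
  open import Relation.Nullary using (¬_; contradiction)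
  open import Relation.Nullary.Decidable using (¬?)

  N : ℕ
  N = 5 ^ suc k

  instance
    N≢0 : NonZero N
    N≢0 = ℕ.m^n≢0 5 (suc k)

  units : List ℕ
  units = units5 (suc k)

  5∣N : 5 ∣ N
  5∣N = m∣m*n (5 ^ k)

  1<N : 1 < N
  1<N = ℕ.<-≤-trans (s≤s (s≤s z≤n)) (ℕ.m≤m*n 5 (5 ^ k) {{ℕ.m^n≢0 5 k}})

  5∣%N⇒5∣ : ∀ a → 5 ∣ a % N → 5 ∣ a
  5∣%N⇒5∣ a 5∣a%N = m%n≡0⇒n∣m a 5 (≡.trans (≡.sym (m∣n⇒o%n%m≡o%m 5 N a 5∣N)) (n∣m⇒m%n≡0 (a % N) 5 5∣a%N))

  5∣⇒5∣%N : ∀ a → 5 ∣ a → 5 ∣ a % N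
  5∣⇒5∣%N a 5∣a = m%n≡0⇒n∣m (a % N) 5 (≡.trans (m∣n⇒o%n%m≡o%m 5 N a 5∣N) (n∣m⇒m%n≡0 a 5 5∣a))

  ∈units⁻ : ∀ {j} → j ∈ units → j < N × ¬ 5 ∣ j
  ∈units⁻ j∈ with ∈-filter⁻ (λ j → ¬? (5 ∣? j)) {xs = map suc (upTo N)} j∈
  ... | j∈1+upTo , 5∤j with ∈-map⁻ suc j∈1+upTo
  ... | i , i<N , refl with ℕ.m≤n⇒m<n∨m≡n (∈-upTo⁻ i<N)
  ...   | inj₁ 1+i<N = 1+i<N , 5∤j
  ...   | inj₂ 1+i≡N = contradiction (≡.subst (5 ∣_) (≡.sym 1+i≡N) 5∣N) 5∤j

  ∈units⁺ : ∀ {j} → j < N → ¬ 5 ∣ j → j ∈ units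
  ∈units⁺ {zero}  _   5∤0 = contradiction (5 ∣0) 5∤0
  ∈units⁺ {suc i} j<N 5∤j = ∈-filter⁺ (λ j → ¬? (5 ∣? j)) (∈-map⁺ suc (∈-upTo⁺ (ℕ.<⇒≤ j<N))) 5∤j

  units-unique : Unique units
  units-unique = Unique.filter⁺ (λ j → ¬? (5 ∣? j)) (Unique.map⁺ ℕ.suc-injective (Unique.upTo⁺ N))

  inverse : ∀ {j} → ¬ 5 ∣ j → ∃ λ j′ → (j * j′) % N ≡ 1
  inverse {j} 5∤j = Bézout⇒inverse N j 1<N (coprime-Bézout (5∤⇒coprime-5^ 5∤j (suc k)))

  %N-*-%N : ∀ x y → ((x % N) * y) % N ≡ (x * y) % N
  %N-*-%N x y = begin
    ((x % N) * y) % N            ≡⟨ %-distribˡ-* (x % N) y N ⟩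
    ((x % N % N) * (y % N)) % N  ≡⟨ cong (λ e → (e * (y % N)) % N) (m%n%n≡m%n x N) ⟩
    ((x % N) * (y % N)) % N      ≡⟨ %-distribˡ-* x y N ⟨
    (x * y) % N                  ∎
    where open ≡.≡-Reasoning

  *-%N∈units : ∀ {u j} → ¬ 5 ∣ u → j ∈ units → (j * u) % N ∈ units
  *-%N∈units {u} {j} 5∤u j∈ = ∈units⁺ (m%n<n (j * u) N)
    (λ 5∣ → [ ∈units⁻ j∈ .proj₂ , 5∤u ]′ (euclidsLemma j u 5-prime (5∣%N⇒5∣ (j * u) 5∣)))

  *-%N-cancel : ∀ {u v j} → (u * v) % N ≡ 1 → j < N → ((j * u) % N * v) % N ≡ j
  *-%N-cancel {u} {v} {j} uv≡1 j<N = begin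
    ((j * u) % N * v) % N  ≡⟨ %N-*-%N (j * u) v ⟩
    (j * u * v) % N        ≡⟨ cong (_% N) (ℕ.*-assoc j u v) ⟩
    (j * (u * v)) % N      ≡⟨ cong (_% N) (ℕ.*-comm j (u * v)) ⟩
    ((u * v) * j) % N      ≡⟨ %N-*-%N (u * v) j ⟨
    ((u * v) % N * j) % N  ≡⟨ cong (λ e → (e * j) % N) uv≡1 ⟩
    (1 * j) % N            ≡⟨ cong (_% N) (ℕ.*-identityˡ j) ⟩
    j % N                  ≡⟨ m<n⇒m%n≡m j<N ⟩
    j                      ∎
    where open ≡.≡-Reasoning

  -- The inverse permutation is multiplication by u⁻¹.
  *-%N-↭ : ∀ {u} → ¬ 5 ∣ u → map (λ j → (j * u) % N) units ↭ units
  *-%N-↭ {u} 5∤u = ∼bag⇒↭ (unique∧set⇒bag ×u-units-unique units-unique (mk⇔ to from))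
    where
    v = inverse 5∤u .proj₁
    uv≡1 = inverse 5∤u .proj₂
    vu≡1 : (v * u) % N ≡ 1
    vu≡1 = ≡.trans (cong (_% N) (ℕ.*-comm v u)) uv≡1
    5∤v : ¬ 5 ∣ v
    5∤v 5∣v with ∣1⇒≡1 (≡.subst (5 ∣_) uv≡1 (5∣⇒5∣%N (u * v) (∣n⇒∣m*n u 5∣v)))
    ... | ()
    ×u ×v : ℕ → ℕ
    ×u j = (j * u) % N
    ×v j = (j * v) % N
    ×u-units-unique : Unique (map ×u units)
    ×u-units-unique = Unique.map⁻ {f = ×v} (≡.subst Unique (≡.sym ×v×u-units) units-unique)
      where
      ×v×u-units : map ×v (map ×u units) ≡ units
      ×v×u-units = ≡.trans (≡.sym (map-∘ units)) (map-id-local (All.tabulate λ j∈ → *-%N-cancel uv≡1 (∈units⁻ j∈ .proj₁)))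
    to : ∀ {z} → z ∈ map ×u units → z ∈ units
    to z∈ with ∈-map⁻ ×u z∈
    ... | j , j∈ , refl = *-%N∈units 5∤u j∈
    from : ∀ {z} → z ∈ units → z ∈ map ×u units
    from {z} z∈ = ≡.subst (_∈ map ×u units) (*-%N-cancel vu≡1 (∈units⁻ z∈ .proj₁)) (∈-map⁺ ×u (*-%N∈units 5∤v z∈))

module Cyclotomic (k : ℕ) where

  open Polynomial
  open Congruence
  open Composition
  open Evaluation
  open CyclotomicFive
  open UnitsModulo k using (N; N≢0)
  open import Data.Nat as ℕ using (ℕ; suc)
  import Data.Nat.Properties as ℕ
  open import Data.Nat.DivMod using (_%_; m%n<n)
  open import Data.Nat.Divisibility using (_∣_; m%n≡0⇒n∣m)
  open import Data.Integer as ℤ using (ℤ; +_)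
  open import Data.List using ([])
  open import Data.Product using (_,_; ∃; proj₁; proj₂)
  open import Data.Unit using (tt)
  open import Relation.Binary.PropositionalEquality using (_≡_)
  open import Relation.Nullary using (¬_)
  open import Tactic.RingSolver using (solve-∀)

  Φ : Poly
  Φ = Φ5 (suc k)

  infix 4 _~_
  _~_ : Poly → Poly → Set
  a ~ b = a ~[ Φ ] b

  M : ℕ
  M = 5 ℕ.^ k

  -- Φ_{5^(k+1)}(x) = Φ₅(x^{5^k}), and y = x^{5^k} is a primitive fifth root of unity modulo Φ.
  y : Poly
  y = monomial M

  Φ≋Φ₅[y] : Φ ≋ Φ₅ y
  Φ≋Φ₅[y] = ≋-trans (+ₚ-cong (monomial-* M 0) (+ₚ-cong (monomial-* M 1) (+ₚ-cong (monomial-* M 2)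
                    (+ₚ-cong (monomial-* M 3) (+ₚ-cong (monomial-* M 4) (≋-refl {[]}))))))
                   (lemma y)
    where
    lemma : ∀ u → u ^ 0 + (u ^ 1 + (u ^ 2 + (u ^ 3 + (u ^ 4 + 0#)))) ≋ 1# + u + u ^ 2 + u ^ 3 + u ^ 4
    lemma = solve-∀ ℤ[x]-solverRing

  Φ₅[y]~0 : Φ₅ y ~ 0#
  Φ₅[y]~0 = ~-trans (≋⇒~ (≋-sym Φ≋Φ₅[y])) modulus~0

  y^5~1 : y ^ 5 ~ 1#
  y^5~1 = begin
    y ^ 5                 ≈⟨ ≋⇒~ (lemma₁ (y ^ 5)) ⟩
    (y ^ 5 - 1#) + 1#     ≈⟨ ≋⇒~ (+ₚ-cong (≋-sym ([u-1]*Φ₅ y)) (≋-refl {1#})) ⟩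
    (y - 1#) * Φ₅ y + 1#  ≈⟨ ~-+ (~-*ˡ (y - 1#) Φ₅[y]~0) (~-refl {a = 1#}) ⟩
    (y - 1#) * 0# + 1#    ≈⟨ ≋⇒~ (lemma₂ (y - 1#)) ⟩
    1#                    ∎
    where
    open ~-Reasoning Φ
    lemma₁ : ∀ a → a ≋ (a - 1#) + 1#
    lemma₁ = solve-∀ ℤ[x]-solverRing
    lemma₂ : ∀ b → b * 0# + 1# ≋ 1#
    lemma₂ = solve-∀ ℤ[x]-solverRing

  x^N~1 : X ^ N ~ 1#
  x^N~1 = ~-trans (≋⇒~ (≋-trans (≋-sym (monomial≋X^ N)) (monomial-* M 5))) y^5~1

  monomial-%N : ∀ a → monomial a ~ monomial (a % N)
  monomial-%N a = begin
    monomial a        ≈⟨ ≋⇒~ (monomial≋X^ a) ⟩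
    X ^ a             ≈⟨ ^-%-~ N x^N~1 a ⟩
    X ^ (a % N)       ≈⟨ ≋⇒~ (≋-sym (monomial≋X^ (a % N))) ⟩
    monomial (a % N)  ∎
    where open ~-Reasoning Φ

  Φ[x^j]~0 : ∀ j → ¬ 5 ∣ j → compose Φ (monomial j) ~ 0#
  Φ[x^j]~0 j 5∤j = begin
    compose Φ (monomial j)       ≈⟨ ≋⇒~ (≋-trans (compose-congˡ (monomial j) Φ≋Φ₅[y]) (compose-Φ₅ y (monomial j))) ⟩
    Φ₅ (compose y (monomial j))  ≈⟨ ≋⇒~ (Φ₅-cong (≋-trans (compose-monomial-monomial M j) (monomial-* M j))) ⟩
    Φ₅ (y ^ j)                   ≈⟨ Φ₅-~ (^-%-~ 5 y^5~1 j) ⟩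
    Φ₅ (y ^ (j % 5))             ≈⟨ ≋⇒~ (Φ₅∣Φ₅[^r] (j % 5) 0<j%5 (m%n<n j 5) y .proj₂) ⟩
    Φ₅ y * q                     ≈⟨ ~-*ʳ q Φ₅[y]~0 ⟩
    0# * q                       ≡⟨⟩
    0#                           ∎
    where
    open ~-Reasoning Φ
    0<j%5 = ℕ.n≢0⇒n>0 (λ j%5≡0 → 5∤j (m%n≡0⇒n∣m j 5 j%5≡0))
    q = Φ₅∣Φ₅[^r] (j % 5) 0<j%5 (m%n<n j 5) y .proj₁

  eval-Φ-1 : eval Φ (+ 1) ≡ + 5
  eval-Φ-1 = const-injective (begin
    const (eval Φ (+ 1))  ≈⟨ ≋-sym (compose-const≋eval Φ (+ 1)) ⟩
    compose Φ 1#          ≈⟨ ≋-trans (compose-congˡ 1# Φ≋Φ₅[y]) (compose-Φ₅ y 1#) ⟩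
    Φ₅ (compose y 1#)     ≈⟨ Φ₅-cong (≋-trans (compose-monomial M 1#) (^-zeroˡ M)) ⟩
    Φ₅ 1#                 ≈⟨ ==⇒≋ (Φ₅ 1#) (const (+ 5)) tt ⟩
    const (+ 5)           ∎)
    where open ≋-Reasoning

  -- From 5 = (y - 1)³ r + s Φ and y - 1 = (x - 1)(1 + x + ⋯ + x^{M-1}).
  5~[x-1]³* : ∃ λ r → const (+ 5) ~ (X - 1#) ^ 3 * r
  5~[x-1]³* = G ^ 3 * r , (begin
    const (+ 5)                  ≈⟨ ≋⇒~ (5≋[u-1]³*+*Φ₅ y .proj₂ .proj₂) ⟩
    (y - 1#) ^ 3 * r + s * Φ₅ y  ≈⟨ ~-+ˡ ((y - 1#) ^ 3 * r) (~-*ˡ s Φ₅[y]~0) ⟩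
    (y - 1#) ^ 3 * r + s * 0#    ≈⟨ ≋⇒~ (lemma₁ (y - 1#) s r) ⟩
    (y - 1#) ^ 3 * r             ≈⟨ ≋⇒~ (*ₚ-congˡ r (^-congˡ 3 y-1≋[x-1]G)) ⟩
    ((X - 1#) * G) ^ 3 * r       ≈⟨ ≋⇒~ (lemma₂ (X - 1#) G r) ⟩
    (X - 1#) ^ 3 * (G ^ 3 * r)   ∎)
    where
    open ~-Reasoning Φ
    r = 5≋[u-1]³*+*Φ₅ y .proj₁
    s = 5≋[u-1]³*+*Φ₅ y .proj₂ .proj₁
    G = geometric X M
    lemma₁ : ∀ a s r → a ^ 3 * r + s * 0# ≋ a ^ 3 * r
    lemma₁ = solve-∀ ℤ[x]-solverRing
    lemma₂ : ∀ z g r → (z * g) ^ 3 * r ≋ z ^ 3 * (g ^ 3 * r)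
    lemma₂ = solve-∀ ℤ[x]-solverRing
    lemma₃ : ∀ p → p - 1# ≋ - (1# - p)
    lemma₃ = solve-∀ ℤ[x]-solverRing
    lemma₄ : ∀ x g → - ((1# - x) * g) ≋ (x - 1#) * g
    lemma₄ = solve-∀ ℤ[x]-solverRing
    y-1≋[x-1]G : y - 1# ≋ (X - 1#) * G
    y-1≋[x-1]G = ≋-trans (+ₚ-cong (monomial≋X^ M) ≋-refl)
      (≋-trans (lemma₃ (X ^ M)) (≋-trans (scale-cong (ℤ.- + 1) (≋-sym ([1-u]*geometric X M))) (lemma₄ X G)))

module Norm (k : ℕ) where
  open import Data.Nat as ℕ using (ℕ; zero; suc)
  import Data.Nat.Properties as ℕ

  open Polynomial
  open Congruence
  open Composition
  open Evaluation
  open UnitsModulo k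
  open Cyclotomic k
  open import Data.Nat.DivMod using (_%_)
  open import Data.Nat.Divisibility as ℕ using (_∣?_)
  open import Relation.Nullary.Decidable using (from-no)
  open import Data.Integer as ℤ using (ℤ; +_)
  open import Data.Integer.Divisibility.Signed using (_∣_; ∣m⇒∣m*n; ∣n⇒∣m*n; ∣m+n∣n⇒∣m; ∣-refl)
  open import Data.List using (List; []; _∷_; map)
  open import Data.List.Properties using (foldr-map)
  open import Data.List.Membership.Propositional using (_∈_)
  open import Data.List.Relation.Unary.Any using (here; there)
  open import Data.Product using (_,_; proj₁; proj₂)
  open import Relation.Binary.PropositionalEquality as ≡ using (_≡_; _≢_; refl; cong; cong₂)
  open import Relation.Nullary using (¬_)
  open import Algebra.Bundles using (CommutativeRing)
  open import Tactic.RingSolver using (solve-∀)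
  open ListProduct (CommutativeRing.*-commutativeMonoid (ℤ[x]/ Φ))

  -- σ j G = G(x^j) is the Galois conjugate G(ω^j), and 𝒩 is the norm N_{k+1} computed in ℤ[x]/(Φ) ≅ ℤ[ω_{k+1}].
  σ : ℕ → Poly → Poly
  σ j G = compose G (monomial j)

  𝒩 : Poly → Poly
  𝒩 G = ∏ (λ j → σ j G) units

  NormIs⇒𝒩~ : ∀ G {m} → NormIs (suc k) G m → 𝒩 G ~ const m
  NormIs⇒𝒩~ G (Q , e) = Q , mk e

  𝒩~⇒NormIs : ∀ G {m} → 𝒩 G ~ const m → NormIs (suc k) G m
  𝒩~⇒NormIs G (Q , mk e) = Q , e

  𝒩-cong : ∀ {A B} → A ~ B → 𝒩 A ~ 𝒩 B
  𝒩-cong A~B = ∏-cong units λ j∈ → compose-~ˡ (monomial _) (Φ[x^j]~0 _ (∈units⁻ j∈ .proj₂)) A~B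

  NormIs-resp-≋ : ∀ {G G′ m} → G ≋ G′ → NormIs (suc k) G m → NormIs (suc k) G′ m
  NormIs-resp-≋ {G} {G′} G≋G′ N[G]≡m = 𝒩~⇒NormIs G′ (~-trans (𝒩-cong (≋⇒~ (≋-sym G≋G′))) (NormIs⇒𝒩~ G N[G]≡m))

  𝒩-* : ∀ A B → 𝒩 (A * B) ~ 𝒩 A * 𝒩 B
  𝒩-* A B = ~-trans (∏-cong units λ {j} _ → ≋⇒~ (compose-* A B (monomial j))) (∏-distrib (λ j → σ j A) (λ j → σ j B) units)

  𝒩-1 : 𝒩 1# ~ 1#
  𝒩-1 = ∏-ε (λ j → σ j 1#) units λ j → ≋⇒~ (compose-const (+ 1) (monomial j))

  𝒩-^ : ∀ A n → 𝒩 (A ^ n) ~ 𝒩 A ^ n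
  𝒩-^ A zero    = 𝒩-1
  𝒩-^ A (suc n) = begin
    𝒩 (A ^ suc n)    ≈⟨ 𝒩-cong (≋⇒~ (^-suc A n)) ⟩
    𝒩 (A * A ^ n)    ≈⟨ 𝒩-* A (A ^ n) ⟩
    𝒩 A * 𝒩 (A ^ n)  ≈⟨ ~-*ˡ (𝒩 A) (𝒩-^ A n) ⟩
    𝒩 A * 𝒩 A ^ n    ≈⟨ ≋⇒~ (≋-sym (^-suc (𝒩 A) n)) ⟩
    𝒩 A ^ suc n      ∎
    where open ~-Reasoning Φ

  -- σ₂ permutes the conjugates, since j ↦ 2j permutes the units modulo 5^(k+1).
  𝒩-σ₂ : ∀ A → 𝒩 (σ 2 A) ~ 𝒩 A
  𝒩-σ₂ A = begin
    𝒩 (σ 2 A)                                          ≈⟨ ∏-cong units (λ {j} _ → σ-σ₂ j) ⟩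
    ∏ (λ j → σ ((j ℕ.* 2) % N) A) units                ≡⟨ foldr-map _ _ _ units ⟨
    ∏ (λ j → σ j A) (map (λ j → (j ℕ.* 2) % N) units)  ≈⟨ ∏-↭ (λ j → σ j A) (*-%N-↭ (from-no (5 ∣? 2))) ⟩
    𝒩 A                                                ∎
    where
    open ~-Reasoning Φ
    σ-σ₂ : ∀ j → σ j (σ 2 A) ~ σ ((j ℕ.* 2) % N) A
    σ-σ₂ j = ~-trans (≋⇒~ (≋-trans (compose-assoc A (monomial 2) (monomial j))
                                   (compose-congʳ A (compose-monomial-monomial 2 j))))
                     (compose-~ʳ A (monomial-%N (j ℕ.* 2)))

  Φ[1]≢0 : eval Φ (+ 1) ≢ + 0
  Φ[1]≢0 Φ[1]≡0 with ≡.trans (≡.sym eval-Φ-1) Φ[1]≡0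
  ... | ()

  σ-[1-x] : ∀ j → σ j (1# - X) ≋ 1# - monomial j
  σ-[1-x] j = ≋-trans (compose-+ 1# (- X) (monomial j))
    (+ₚ-cong (compose-const (+ 1) (monomial j))
             (≋-trans (compose-neg X (monomial j)) (scale-cong (ℤ.- + 1) (compose-X (monomial j)))))

  -- x is a power of x^j modulo Φ, so 1 - x^j divides 1 - x.
  [1-x^j]*-cancel : ∀ {j} → ¬ 5 ℕ.∣ j → ∀ S → (1# - monomial j) * S ~ 0# → S ~ 0#
  [1-x^j]*-cancel {j} 5∤j S [1-x^j]S~0 = [1-x]*-cancel-mod Φ[1]≢0 S (begin
    (1# - X) * S                     ≈⟨ ~-*ʳ S (~-+ˡ 1# (~-neg x~u^j′)) ⟩
    (1# - u ^ j′) * S                ≈⟨ ≋⇒~ (*ₚ-congˡ S (≋-sym ([1-u]*geometric u j′))) ⟩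
    ((1# - u) * geometric u j′) * S  ≈⟨ ≋⇒~ (lemma (1# - u) (geometric u j′) S) ⟩
    geometric u j′ * ((1# - u) * S)  ≈⟨ ~-*ˡ (geometric u j′) [1-x^j]S~0 ⟩
    geometric u j′ * 0#              ≈⟨ ≋⇒~ (*ₚ-zeroʳ (geometric u j′)) ⟩
    0#                               ∎)
    where
    open ~-Reasoning Φ
    u = monomial j
    j′ = inverse 5∤j .proj₁
    x~u^j′ : X ~ u ^ j′
    x~u^j′ = ~-sym (begin
      u ^ j′                     ≈⟨ ≋⇒~ (≋-sym (monomial-* j j′)) ⟩
      monomial (j′ ℕ.* j)        ≈⟨ monomial-%N (j′ ℕ.* j) ⟩
      monomial ((j′ ℕ.* j) % N)  ≡⟨ cong monomial (≡.trans (cong (_% N) (ℕ.*-comm j′ j)) (inverse 5∤j .proj₂)) ⟩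
      X                          ∎)
    lemma : ∀ a g s → (a * g) * s ≋ g * (a * s)
    lemma = solve-∀ ℤ[x]-solverRing

  ∏σ[1-x]*-cancel : ∀ js → (∀ {j} → j ∈ js → ¬ 5 ℕ.∣ j) → ∀ S → ∏ (λ j → σ j (1# - X)) js * S ~ 0# → S ~ 0#
  ∏σ[1-x]*-cancel []       _   S 1S~0  = ~-trans (≋⇒~ (≋-sym (*ₚ-identityˡ S))) 1S~0
  ∏σ[1-x]*-cancel (j ∷ js) 5∤js S ∏S~0 = ∏σ[1-x]*-cancel js (λ j∈ → 5∤js (there j∈)) S
    ([1-x^j]*-cancel (5∤js (here refl)) _
      (~-trans (≋⇒~ (≋-trans (*ₚ-congˡ _ (≋-sym (σ-[1-x] j))) (≋-sym (*ₚ-assoc (σ j (1# - X)) _ S)))) ∏S~0))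

  𝒩[1-x]*-cancel : ∀ S → 𝒩 (1# - X) * S ~ 0# → S ~ 0#
  𝒩[1-x]*-cancel = ∏σ[1-x]*-cancel units (λ j∈ → ∈units⁻ j∈ .proj₂)

  -- 𝒩 x is idempotent by σ₂-invariance, and invertible since x^N ≡ 1.
  𝒩-x : 𝒩 X ~ 1#
  𝒩-x = begin
    a            ≈⟨ ≋⇒~ (≋-sym (*ₚ-identityʳ a)) ⟩
    a * 1#       ≈⟨ ~-*ˡ a (~-sym ab~1) ⟩
    a * (a * b)  ≈⟨ ≋⇒~ (≋-sym (*ₚ-assoc a a b)) ⟩
    (a * a) * b  ≈⟨ ~-*ʳ b aa~a ⟩
    a * b        ≈⟨ ab~1 ⟩
    1#           ∎
    where
    open ~-Reasoning Φ
    a b : Poly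
    a = 𝒩 X
    b = 𝒩 (X ^ (N ℕ.∸ 1))
    aa~a : a * a ~ a
    aa~a = ~-trans (~-sym (𝒩-* X X))
           (~-trans (𝒩-cong (≋⇒~ (≋-sym (≋-trans (compose-X (monomial 2)) (monomial≋X^ 2))))) (𝒩-σ₂ X))
    x*x^[N-1]~1 : X * X ^ (N ℕ.∸ 1) ~ 1#
    x*x^[N-1]~1 = ~-trans (≋⇒~ (≋-trans (≋-sym (^-suc X (N ℕ.∸ 1))) (≡⇒≋ (cong (X ^_) (ℕ.suc-pred N))))) x^N~1
    ab~1 : a * b ~ 1#
    ab~1 = ~-trans (~-sym (𝒩-* X (X ^ (N ℕ.∸ 1)))) (~-trans (𝒩-cong x*x^[N-1]~1) 𝒩-1)

  -- (1 + x)(1 - x) = σ₂(1 - x), so 𝒩(1 + x) 𝒩(1 - x) ≡ 𝒩(1 - x), and 𝒩(1 - x) can be cancelled.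
  𝒩-1+x : 𝒩 (1# + X) ~ 1#
  𝒩-1+x = begin
    P              ≈⟨ ≋⇒~ (lemma₂ P) ⟩
    (P - 1#) + 1#  ≈⟨ ~-+ (𝒩[1-x]*-cancel (P - 1#) A[P-1]~0) (~-refl {a = 1#}) ⟩
    0# + 1#        ≈⟨ ~-refl ⟩
    1#             ∎
    where
    open ~-Reasoning Φ
    P A : Poly
    P = 𝒩 (1# + X)
    A = 𝒩 (1# - X)
    lemma₁ : ∀ x → (1# + x) * (1# - x) ≋ 1# - x ^ 2
    lemma₁ = solve-∀ ℤ[x]-solverRing
    lemma₂ : ∀ P → P ≋ (P - 1#) + 1#
    lemma₂ = solve-∀ ℤ[x]-solverRing
    lemma₃ : ∀ A P → A * (P - 1#) ≋ P * A - A
    lemma₃ = solve-∀ ℤ[x]-solverRing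
    PA~A : P * A ~ A
    PA~A = begin
      P * A                    ≈⟨ ~-sym (𝒩-* (1# + X) (1# - X)) ⟩
      𝒩 ((1# + X) * (1# - X))  ≈⟨ 𝒩-cong (≋⇒~ (lemma₁ X)) ⟩
      𝒩 (1# - X ^ 2)           ≈⟨ 𝒩-cong (≋⇒~ (≋-sym σ₂[1-x]≋)) ⟩
      𝒩 (σ 2 (1# - X))         ≈⟨ 𝒩-σ₂ (1# - X) ⟩
      A                        ∎
      where
      σ₂[1-x]≋ : σ 2 (1# - X) ≋ 1# - X ^ 2
      σ₂[1-x]≋ = ≋-trans (σ-[1-x] 2) (+ₚ-cong (≋-refl {1#}) (scale-cong (ℤ.- + 1) (monomial≋X^ 2)))
    A[P-1]~0 : A * (P - 1#) ~ 0#
    A[P-1]~0 = ~-trans (≋⇒~ (lemma₃ A P)) (~-trans (~-+ PA~A (~-refl {a = - A})) (≋⇒~ (negₚ-inverseʳ A)))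

  𝒩-x^s[1+x]^t : ∀ s t → 𝒩 (X ^ s * (1# + X) ^ t) ~ 1#
  𝒩-x^s[1+x]^t s t = begin
    𝒩 (X ^ s * (1# + X) ^ t)      ≈⟨ 𝒩-* (X ^ s) ((1# + X) ^ t) ⟩
    𝒩 (X ^ s) * 𝒩 ((1# + X) ^ t)  ≈⟨ ~-* (𝒩-^ X s) (𝒩-^ (1# + X) t) ⟩
    𝒩 X ^ s * 𝒩 (1# + X) ^ t      ≈⟨ ~-* (~-^ s 𝒩-x) (~-^ t 𝒩-1+x) ⟩
    1# ^ s * 1# ^ t               ≈⟨ ≋⇒~ (*ₚ-cong (^-zeroˡ s) (^-zeroˡ t)) ⟩
    1# * 1#                       ≈⟨ ≋⇒~ (*ₚ-identityˡ 1#) ⟩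
    1#                            ∎
    where open ~-Reasoning Φ

  σ-at-1 : ∀ j G → eval (σ j G) (+ 1) ≡ eval G (+ 1)
  σ-at-1 j G = ≡.trans (eval-compose G (monomial j) (+ 1)) (cong (eval G) (eval-monomial-1 j))

  5∣∏σ-at-1 : ∀ G → + 5 ∣ eval G (+ 1) → ∀ {j js} → j ∈ js → + 5 ∣ eval (∏ (λ j → σ j G) js) (+ 1)
  5∣∏σ-at-1 G 5∣G[1] {js = j ∷ js} j∈ = ≡.subst (+ 5 ∣_) (≡.sym (eval-* (σ j G) (∏ (λ j → σ j G) js) (+ 1))) (5∣head-or-tail j∈)
    where
    5∣head-or-tail : ∀ {i} → i ∈ j ∷ js → + 5 ∣ eval (σ j G) (+ 1) ℤ.* eval (∏ (λ j → σ j G) js) (+ 1)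
    5∣head-or-tail (here refl) = ∣m⇒∣m*n _ (≡.subst (+ 5 ∣_) (≡.sym (σ-at-1 j G)) 5∣G[1])
    5∣head-or-tail (there i∈)  = ∣n⇒∣m*n (eval (σ j G) (+ 1)) (5∣∏σ-at-1 G 5∣G[1] i∈)

  -- At x = 1 every conjugate σ j G takes the value G(1), and Φ takes the value 5.
  5∣at-1⇒5∣norm : ∀ G {m} → NormIs (suc k) G m → + 5 ∣ eval G (+ 1) → + 5 ∣ m
  5∣at-1⇒5∣norm G {m} (Q , 𝒩G≈m+ΦQ) 5∣G[1] = ∣m+n∣n⇒∣m (≡.subst (+ 5 ∣_) 𝒩G[1]≡ (5∣∏σ-at-1 G 5∣G[1] 1∈units)) (∣m⇒∣m*n _ ∣-refl)
    where
    1∈units : 1 ∈ units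
    1∈units = ∈units⁺ 1<N (from-no (5 ∣? 1))
    𝒩G[1]≡ : eval (𝒩 G) (+ 1) ≡ m ℤ.+ + 5 ℤ.* eval Q (+ 1)
    𝒩G[1]≡ = begin
      eval (𝒩 G) (+ 1)                             ≡⟨ eval-cong {𝒩 G} {const m + Φ * Q} (+ 1) (mk 𝒩G≈m+ΦQ) ⟩
      eval (const m + Φ * Q) (+ 1)                 ≡⟨ eval-+ (const m) (Φ * Q) (+ 1) ⟩
      eval (const m) (+ 1) ℤ.+ eval (Φ * Q) (+ 1)  ≡⟨ cong₂ ℤ._+_ (eval-const m (+ 1)) (eval-* Φ Q (+ 1)) ⟩
      m ℤ.+ eval Φ (+ 1) ℤ.* eval Q (+ 1)          ≡⟨ cong (λ e → m ℤ.+ e ℤ.* eval Q (+ 1)) eval-Φ-1 ⟩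
      m ℤ.+ + 5 ℤ.* eval Q (+ 1)                   ∎
      where open ≡.≡-Reasoning

module Truncated where

  open import Data.Nat as ℕ using (ℕ; zero; suc)
  open import Data.Integer as ℤ using (ℤ; +_; _+_; _*_; _-_; _%ℕ_; _/ℕ_)
  import Data.Integer.Properties as ℤ
  open import Data.Integer.DivMod using (a≡a%ℕn+[a/ℕn]*n; n%ℕd<d)
  open import Data.Integer.Divisibility.Signed using (_∣_; divides; ∣n⇒∣m*n; ∣m∣n⇒∣m+n)
  open import Data.Integer.Tactic.RingSolver using (solve-∀)
  import Data.Nat.Properties as ℕ
  open import Function.Bundles using (Equivalence)
  open import Function using (_$_)
  open import Relation.Binary.PropositionalEquality as ≡ using (_≡_; cong)
  open import Data.Fin as Fin using (Fin; toℕ; fromℕ<)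
  open import Data.Fin.Properties using (all?; any?; toℕ-fromℕ<)
  open import Data.Product using (_×_; _,_; ∃; ∃₂)
  open import Data.Bool using (Bool; T; _∧_)
  open import Data.Bool.Properties using (T?; T-∧)
  open import Relation.Nullary.Decidable using (from-yes)
  open import Relation.Nullary using (¬_; contradiction)

  -- a + b z + c z² in ℤ[z]/(z³), where z = x - 1.
  Tri : Set
  Tri = ℤ × ℤ × ℤ

  infixl 7 _⊛_
  _⊛_ : Tri → Tri → Tri
  (a , b , c) ⊛ (a′ , b′ , c′) = a * a′ , a * b′ + b * a′ , a * c′ + b * b′ + c * a′

  _⊛^_ : Tri → ℕ → Tri
  v ⊛^ zero  = + 1 , + 0 , + 0
  v ⊛^ suc n = v ⊛ (v ⊛^ n)

  unit₃ : ℕ → ℕ → Tri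
  unit₃ s t = ((+ 1 , + 1 , + 0) ⊛^ s) ⊛ ((+ 2 , + 1 , + 0) ⊛^ t)

  ≡0-mod5? : ℤ → Bool
  ≡0-mod5? x = (x %ℕ 5) ℕ.≡ᵇ 0

  ≡[1,0,0]-mod5? : Tri → Bool
  ≡[1,0,0]-mod5? (a , b , c) = ≡0-mod5? (a - + 1) ∧ ≡0-mod5? b ∧ ≡0-mod5? c

  -- x^s (1 + x)^t brings the residue class of (1 + a) + b z + c z² modulo (5, z³) to 1.
  Reduces : ℕ → ℕ → Fin 4 → Fin 5 → Fin 5 → Set
  Reduces s t a b c = T (≡[1,0,0]-mod5? (unit₃ s t ⊛ (+ suc (toℕ a) , + toℕ b , + toℕ c)))

  -- x and 1 + x generate the 100 units of (ℤ/5)[z]/(z³); exhaustive search finds the exponents.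
  -- The search is opaque so that it is only ever evaluated here.
  opaque
    unit₃-exists : ∀ a b c → ∃₂ λ (s : Fin 5) (t : Fin 20) → Reduces (toℕ s) (toℕ t) a b c
    unit₃-exists = from-yes (all? {n = 4} λ a → all? {n = 5} λ b → all? {n = 5} λ c →
      any? {n = 5} {P = λ s → ∃ λ t → Reduces (toℕ s) (toℕ t) a b c} λ s →
      any? {n = 20} {P = λ t → Reduces (toℕ s) (toℕ t) a b c} λ t → T? _)

  infix 4 _≡₅_ _≡₅³_
  record _≡₅_ (x y : ℤ) : Set where
    constructor mk
    field 5∣- : + 5 ∣ x - y

  _≡₅³_ : Tri → Tri → Set
  (a , b , c) ≡₅³ (a′ , b′ , c′) = a ≡₅ a′ × b ≡₅ b′ × c ≡₅ c′

  ≡₅-trans : ∀ {x y z} → x ≡₅ y → y ≡₅ z → x ≡₅ z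
  ≡₅-trans {x} {y} {z} (mk x≡y) (mk y≡z) = mk (≡.subst (+ 5 ∣_) (lemma x y z) (∣m∣n⇒∣m+n x≡y y≡z))
    where
    lemma : ∀ x y z → (x - y) + (y - z) ≡ x - z
    lemma = solve-∀

  ≡₅-+ : ∀ {x x′ y y′} → x ≡₅ x′ → y ≡₅ y′ → x + y ≡₅ x′ + y′
  ≡₅-+ {x} {x′} {y} {y′} (mk x≡x′) (mk y≡y′) = mk (≡.subst (+ 5 ∣_) (lemma x x′ y y′) (∣m∣n⇒∣m+n x≡x′ y≡y′))
    where
    lemma : ∀ x x′ y y′ → (x - x′) + (y - y′) ≡ (x + y) - (x′ + y′)
    lemma = solve-∀

  ≡₅-*ˡ : ∀ u {x x′} → x ≡₅ x′ → u * x ≡₅ u * x′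
  ≡₅-*ˡ u {x} {x′} (mk x≡x′) = mk (≡.subst (+ 5 ∣_) (lemma u x x′) (∣n⇒∣m*n u x≡x′))
    where
    lemma : ∀ u x x′ → u * (x - x′) ≡ u * x - u * x′
    lemma = solve-∀

  ⊛-congˡ : ∀ u {v v′} → v ≡₅³ v′ → u ⊛ v ≡₅³ u ⊛ v′
  ⊛-congˡ (u₁ , u₂ , u₃) (a≡ , b≡ , c≡) =
    ≡₅-*ˡ u₁ a≡ ,
    ≡₅-+ (≡₅-*ˡ u₁ b≡) (≡₅-*ˡ u₂ a≡) ,
    ≡₅-+ (≡₅-+ (≡₅-*ˡ u₁ c≡) (≡₅-*ˡ u₂ b≡)) (≡₅-*ˡ u₃ a≡)

  ≡₅-%ℕ5 : ∀ x → x ≡₅ + (x %ℕ 5)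
  ≡₅-%ℕ5 x = mk $ divides (x /ℕ 5) (≡.trans (cong (_- + (x %ℕ 5)) (a≡a%ℕn+[a/ℕn]*n x 5)) (lemma (+ (x %ℕ 5)) (x /ℕ 5 * + 5)))
    where
    lemma : ∀ r q → (r + q) - r ≡ q
    lemma = solve-∀

  ≡0-mod5?-sound : ∀ x → T (≡0-mod5? x) → x ≡₅ + 0
  ≡0-mod5?-sound x x%5≡0 = ≡.subst (λ r → x ≡₅ + r) (ℕ.≡ᵇ⇒≡ (x %ℕ 5) 0 x%5≡0) (≡₅-%ℕ5 x)

  ≡[1,0,0]-mod5?-sound : ∀ v → T (≡[1,0,0]-mod5? v) → v ≡₅³ (+ 1 , + 0 , + 0)
  ≡[1,0,0]-mod5?-sound (a , b , c) ok with Equivalence.to T-∧ ok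
  ... | a-1≡0 , b,c≡0 with Equivalence.to T-∧ b,c≡0
  ... | b≡0 , c≡0 = mk (≡.subst (+ 5 ∣_) (ℤ.+-identityʳ (a - + 1)) (_≡₅_.5∣- (≡0-mod5?-sound (a - + 1) a-1≡0))) ,
                    ≡0-mod5?-sound b b≡0 , ≡0-mod5?-sound c c≡0

  ≡₅³-trans : ∀ {u v w} → u ≡₅³ v → v ≡₅³ w → u ≡₅³ w
  ≡₅³-trans (a≡ , b≡ , c≡) (a≡′ , b≡′ , c≡′) = ≡₅-trans a≡ a≡′ , ≡₅-trans b≡ b≡′ , ≡₅-trans c≡ c≡′

  unit₃-reduces : ∀ a b c → ¬ + 5 ∣ a → ∃₂ λ s t → unit₃ s t ⊛ (a , b , c) ≡₅³ (+ 1 , + 0 , + 0)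
  unit₃-reduces a b c 5∤a = reduce (a %ℕ 5) (≡₅-%ℕ5 a) (n%ℕd<d a 5)
    where
    reduce : ∀ r → a ≡₅ + r → r ℕ.< 5 → ∃₂ λ s t → unit₃ s t ⊛ (a , b , c) ≡₅³ (+ 1 , + 0 , + 0)
    reduce zero    a≡0 _   = contradiction (≡.subst (+ 5 ∣_) (ℤ.+-identityʳ a) (_≡₅_.5∣- a≡0)) 5∤a
    reduce (suc r) a≡r r<5 with unit₃-exists (fromℕ< (ℕ.s<s⁻¹ r<5)) (fromℕ< (n%ℕd<d b 5)) (fromℕ< (n%ℕd<d c 5))
    ... | s , t , reduces = toℕ s , toℕ t ,
      ≡₅³-trans (⊛-congˡ U (a≡r , ≡₅-%ℕ5 b , ≡₅-%ℕ5 c))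
                (≡[1,0,0]-mod5?-sound (U ⊛ residues) (≡.subst (λ v → T (≡[1,0,0]-mod5? (U ⊛ v))) residues≡ reduces))
      where
      U = unit₃ (toℕ s) (toℕ t)
      residues = + suc r , + (b %ℕ 5) , + (c %ℕ 5)
      residues≡ : (+ suc (toℕ (fromℕ< (ℕ.s<s⁻¹ r<5))) , + toℕ (fromℕ< (n%ℕd<d b 5)) , + toℕ (fromℕ< (n%ℕd<d c 5)))
                ≡ residues
      residues≡ = ≡.cong₂ _,_ (cong (λ n → + suc n) (toℕ-fromℕ< (ℕ.s<s⁻¹ r<5)))
                    (≡.cong₂ _,_ (cong +_ (toℕ-fromℕ< (n%ℕd<d b 5))) (cong +_ (toℕ-fromℕ< (n%ℕd<d c 5))))

module Taylor where

  open Polynomial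
  open Composition
  open Evaluation
  open Truncated
  open import Data.Nat using (zero; suc)
  open import Data.Integer as ℤ using (ℤ; +_)
  import Data.Integer.Properties as ℤ
  open import Data.Integer.Divisibility.Signed using (divides)
  open import Data.List using ([])
  open import Data.Product using (_,_; ∃; ∃₂; proj₁; proj₂)
  open import Data.Unit using (tt)
  open import Relation.Binary.PropositionalEquality as ≡ using (_≡_; cong)
  open import Tactic.RingSolver using (solve-∀)

  z : Poly
  z = X - 1#

  z^ₚ3≋z^3 : z ^ₚ 3 ≋ z ^ 3
  z^ₚ3≋z^3 = lemma z
    where
    lemma : ∀ z → z * (z * (z * 1#)) ≋ z ^ 3
    lemma = solve-∀ ℤ[x]-solverRing

  -- The Taylor expansion at x = 1 up to order two, with remainder R.
  ⟦_⟧+z³_ : Tri → Poly → Poly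
  ⟦ a , b , c ⟧+z³ R = const a + z * (const b + z * (const c + z * R))

  taylor : ∀ f → ∃₂ λ b c → ∃ λ R → f ≋ ⟦ eval f (+ 1) , b , c ⟧+z³ R
  taylor f with ≋eval+[x-1]* f
  ... | f₁ , f≋ with ≋eval+[x-1]* f₁
  ... | f₂ , f₁≋ with ≋eval+[x-1]* f₂
  ... | R , f₂≋ = eval f₁ (+ 1) , eval f₂ (+ 1) , R ,
    ≋-trans f≋ (+ₚ-cong (≋-refl {const (eval f (+ 1))})
      (*ₚ-congʳ z (≋-trans f₁≋ (+ₚ-cong (≋-refl {const (eval f₁ (+ 1))}) (*ₚ-congʳ z f₂≋)))))

  ⊛-sound : ∀ u R v S → ∃ λ T → ⟦ u ⟧+z³ R * ⟦ v ⟧+z³ S ≋ ⟦ u ⊛ v ⟧+z³ T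
  ⊛-sound (a , b , c) R (a′ , b′ , c′) S =
    T ,
    ≋-trans (lemma z A B C R A′ B′ C′ S)
      (+ₚ-cong (≋-sym (const-* a a′)) (*ₚ-congʳ z (+ₚ-cong (≋-sym (+ₚ-cong (const-* a b′) (const-* b a′)))
        (*ₚ-congʳ z (+ₚ-cong (≋-sym (+ₚ-cong (+ₚ-cong (const-* a c′) (const-* b b′)) (const-* c a′))) (≋-refl {z * T}))))))
    where
    A B C A′ B′ C′ T : Poly
    T = A * S + B * C′ + C * B′ + R * A′ + z * (B * S + C * C′ + R * B′ + z * (C * S + R * C′ + z * (R * S)))
    A = const a ; B = const b ; C = const c ; A′ = const a′ ; B′ = const b′ ; C′ = const c′
    lemma : ∀ z A B C R A′ B′ C′ S →
      (A + z * (B + z * (C + z * R))) * (A′ + z * (B′ + z * (C′ + z * S)))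
      ≋ A * A′ + z * ((A * B′ + B * A′) + z * ((A * C′ + B * B′ + C * A′)
          + z * (A * S + B * C′ + C * B′ + R * A′ + z * (B * S + C * C′ + R * B′ + z * (C * S + R * C′ + z * (R * S))))))
    lemma = solve-∀ ℤ[x]-solverRing

  ⊛^-sound : ∀ u R n → ∃ λ T → (⟦ u ⟧+z³ R) ^ n ≋ ⟦ u ⊛^ n ⟧+z³ T
  ⊛^-sound u R zero    = [] , ==⇒≋ 1# (⟦ + 1 , + 0 , + 0 ⟧+z³ []) tt
  ⊛^-sound u R (suc n) = ⊛-sound u R (u ⊛^ n) T .proj₁ ,
    ≋-trans (^-suc (⟦ u ⟧+z³ R) n) (≋-trans (*ₚ-congʳ (⟦ u ⟧+z³ R) uⁿ≋) (⊛-sound u R (u ⊛^ n) T .proj₂))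
    where
    T = ⊛^-sound u R n .proj₁
    uⁿ≋ = ⊛^-sound u R n .proj₂

  unit₃-sound : ∀ s t → ∃ λ T → X ^ s * (1# + X) ^ t ≋ ⟦ unit₃ s t ⟧+z³ T
  unit₃-sound s t = ⊛-sound (xₜ ⊛^ s) (xˢ .proj₁) ([1+x]ₜ ⊛^ t) ([1+x]ᵗ .proj₁) .proj₁ ,
    ≋-trans (*ₚ-cong (≋-trans (^-congˡ s x≋) (xˢ .proj₂)) (≋-trans (^-congˡ t 1+x≋) ([1+x]ᵗ .proj₂)))
            (⊛-sound (xₜ ⊛^ s) (xˢ .proj₁) ([1+x]ₜ ⊛^ t) ([1+x]ᵗ .proj₁) .proj₂)
    where
    xₜ [1+x]ₜ : Tri
    xₜ = + 1 , + 1 , + 0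
    [1+x]ₜ = + 2 , + 1 , + 0
    x≋ : X ≋ ⟦ + 1 , + 1 , + 0 ⟧+z³ []
    x≋ = ==⇒≋ _ _ tt
    1+x≋ : 1# + X ≋ ⟦ + 2 , + 1 , + 0 ⟧+z³ []
    1+x≋ = ==⇒≋ _ _ tt
    xˢ = ⊛^-sound xₜ [] s
    [1+x]ᵗ = ⊛^-sound [1+x]ₜ [] t

  ≡₅³[1,0,0]-sound : ∀ {v} R → v ≡₅³ (+ 1 , + 0 , + 0) → ∃ λ w → ⟦ v ⟧+z³ R ≋ 1# + const (+ 5) * w + z ^ 3 * R
  ≡₅³[1,0,0]-sound {a , b , c} R (mk (divides α a-1≡α5) , mk (divides β b≡β5) , mk (divides γ c≡γ5)) =
    const α + z * (const β + z * const γ) ,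
    ≋-trans (+ₚ-cong (≋-trans (≡⇒≋ (cong const (a≡ a α a-1≡α5))) (+ₚ-cong (≋-refl {1#}) (const-* (+ 5) α)))
            (*ₚ-congʳ z (+ₚ-cong (≋-trans (≡⇒≋ (cong const (b≡ b β b≡β5))) (const-* (+ 5) β))
            (*ₚ-congʳ z (+ₚ-cong (≋-trans (≡⇒≋ (cong const (b≡ c γ c≡γ5))) (const-* (+ 5) γ)) (≋-refl {z * R}))))))
    (lemma z (const (+ 5)) (const α) (const β) (const γ) R)
    where
    open import Data.Integer.Tactic.RingSolver using () renaming (solve-∀ to solve-∀ℤ)
    a≡ : ∀ a α → a ℤ.- + 1 ≡ α ℤ.* + 5 → a ≡ + 1 ℤ.+ + 5 ℤ.* α
    a≡ a α eq = ≡.trans (lemma₁ a) (≡.trans (cong (ℤ._+ + 1) eq) (lemma₂ α))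
      where
      lemma₁ : ∀ a → a ≡ (a ℤ.- + 1) ℤ.+ + 1
      lemma₁ = solve-∀ℤ
      lemma₂ : ∀ α → α ℤ.* + 5 ℤ.+ + 1 ≡ + 1 ℤ.+ + 5 ℤ.* α
      lemma₂ = solve-∀ℤ
    b≡ : ∀ b β → b ℤ.- + 0 ≡ β ℤ.* + 5 → b ≡ + 5 ℤ.* β
    b≡ b β eq = ≡.trans (≡.sym (ℤ.+-identityʳ b)) (≡.trans eq (ℤ.*-comm β (+ 5)))
    lemma : ∀ z five α β γ R → 1# + five * α + z * (five * β + z * (five * γ + z * R))
                             ≋ 1# + five * (α + z * (β + z * γ)) + z ^ 3 * R
    lemma = solve-∀ ℤ[x]-solverRing

module Residue (k : ℕ) where

  open Polynomial
  open Congruence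
  open Cyclotomic k
  open Norm k
  open import Data.Nat using (suc)
  open Truncated
  open Taylor
  open import Data.Integer using (+_)
  open import Data.Integer.Divisibility.Signed using (_∣_)
  open import Data.Product using (_,_; ∃; ∃₂; proj₁; proj₂)
  open import Relation.Nullary using (¬_)
  open import Tactic.RingSolver using (solve-∀)

  -- Multiply by a unit x^s (1 + x)^t to make f ≡ 1 modulo (5, (x - 1)³), then use 5 ∈ ((x - 1)³) modulo Φ.
  x^s[1+x]^t*f~1+z³h : ∀ f → ¬ + 5 ∣ eval f (+ 1) → ∃₂ λ s t → ∃ λ h → X ^ s * (1# + X) ^ t * f ~ 1# + z ^ 3 * h
  x^s[1+x]^t*f~1+z³h f 5∤f[1] = s , t , r * w + T′ , (begin
    X ^ s * (1# + X) ^ t * f           ≈⟨ ≋⇒~ (*ₚ-cong (unit₃-sound s t .proj₂) f≋) ⟩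
    ⟦ U ⟧+z³ T * ⟦ abc ⟧+z³ R          ≈⟨ ≋⇒~ (⊛-sound U T abc R .proj₂) ⟩
    ⟦ U ⊛ abc ⟧+z³ T′                  ≈⟨ ≋⇒~ (≡₅³[1,0,0]-sound T′ U⊛abc≡₅1 .proj₂) ⟩
    1# + const (+ 5) * w + z ^ 3 * T′  ≈⟨ ~-+ (~-+ˡ 1# (~-*ʳ w 5~z³r)) (~-refl {a = z ^ 3 * T′}) ⟩
    1# + z ^ 3 * r * w + z ^ 3 * T′    ≈⟨ ≋⇒~ (lemma (z ^ 3) r w T′) ⟩
    1# + z ^ 3 * (r * w + T′)          ∎)
    where
    open ~-Reasoning Φ
    b = taylor f .proj₁
    c = taylor f .proj₂ .proj₁
    R = taylor f .proj₂ .proj₂ .proj₁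
    f≋ = taylor f .proj₂ .proj₂ .proj₂
    abc = eval f (+ 1) , b , c
    s = unit₃-reduces (eval f (+ 1)) b c 5∤f[1] .proj₁
    t = unit₃-reduces (eval f (+ 1)) b c 5∤f[1] .proj₂ .proj₁
    U⊛abc≡₅1 = unit₃-reduces (eval f (+ 1)) b c 5∤f[1] .proj₂ .proj₂
    U = unit₃ s t
    T = unit₃-sound s t .proj₁
    T′ = ⊛-sound U T abc R .proj₁
    w = ≡₅³[1,0,0]-sound T′ U⊛abc≡₅1 .proj₁
    r = 5~[x-1]³* .proj₁
    5~z³r = 5~[x-1]³* .proj₂
    lemma : ∀ Z r w T′ → 1# + Z * r * w + Z * T′ ≋ 1# + Z * (r * w + T′)
    lemma = solve-∀ ℤ[x]-solverRing

  -- The unit x^s (1 + x)^t has norm 1, so it can be absorbed into f.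
  norm-of-1+z³h : ∀ f {m} → ¬ + 5 ∣ m → NormIs (suc k) f m → ∃ λ h → NormIs (suc k) (1# + z ^ₚ 3 * h) m
  norm-of-1+z³h f {m} 5∤m N[f]≡m = h , NormIs-resp-≋ (+ₚ-cong (≋-refl {1#}) (*ₚ-congˡ h (≋-sym z^ₚ3≋z^3)))
    (𝒩~⇒NormIs (1# + z ^ 3 * h) (begin
      𝒩 (1# + z ^ 3 * h)              ≈⟨ 𝒩-cong (~-sym u*f~1+z³h) ⟩
      𝒩 (X ^ s * (1# + X) ^ t * f)    ≈⟨ 𝒩-* (X ^ s * (1# + X) ^ t) f ⟩
      𝒩 (X ^ s * (1# + X) ^ t) * 𝒩 f  ≈⟨ ~-* (𝒩-x^s[1+x]^t s t) (NormIs⇒𝒩~ f N[f]≡m) ⟩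
      1# * const m                    ≈⟨ ≋⇒~ (*ₚ-identityˡ (const m)) ⟩
      const m                         ∎))
    where
    open ~-Reasoning Φ
    found = x^s[1+x]^t*f~1+z³h f (λ 5∣f[1] → 5∤m (5∣at-1⇒5∣norm f N[f]≡m 5∣f[1]))
    s = found .proj₁
    t = found .proj₂ .proj₁
    h = found .proj₂ .proj₂ .proj₁
    u*f~1+z³h = found .proj₂ .proj₂ .proj₂

module Case-i≡1 where

  open Polynomial
  open Congruence
  open Evaluation using (eval-*)
  open Taylor using (z; z^ₚ3≋z^3)
  open Cyclotomic 0
  open Norm 0
  open import Data.Integer as ℤ using (+_)
  import Data.Integer.Properties as ℤ
  open import Data.List using ([]; _∷_)
  open import Data.Product using (_,_)
  open import Data.Unit using (tt)
  open import Relation.Binary.PropositionalEquality as ≡ using (_≡_)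
  open import Tactic.RingSolver using (solve-∀)

  E : Poly
  E = 1# + z * (const (+ 2) + const (+ 2) * z + z ^ 2)

  Φ≋z⁴+5E : Φ ≋ z ^ 4 + const (+ 5) * E
  Φ≋z⁴+5E = ==⇒≋ _ _ tt

  -- ∏ⱼ (1 - xʲ) = 5 + Φ₅ (x⁶ - 2x⁵ + x³ + 3x - 4)
  𝒩[1-x]~5 : 𝒩 (1# - X) ~ const (+ 5)
  𝒩[1-x]~5 = (ℤ.-[1+ 3 ] ∷ + 3 ∷ + 0 ∷ + 1 ∷ + 0 ∷ ℤ.-[1+ 1 ] ∷ + 1 ∷ []) , ==⇒≋ _ _ tt

  -- (1 - x) z³ = -z⁴ ≡ 5E modulo Φ₅
  [1-x]*[1+z³h]~ : ∀ h → (1# - X) * (1# + z ^ 3 * h) ~ 1# - X + const (+ 5) * (E * h)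
  [1-x]*[1+z³h]~ h = begin
    (1# - X) * (1# + z ^ 3 * h)                                    ≈⟨ ≋⇒~ (*ₚ-congˡ (1# + z ^ 3 * h) 1-x≋-z) ⟩
    - z * (1# + z ^ 3 * h)                                         ≈⟨ ≋⇒~ (lemma₁ z E h) ⟩
    - z + const (+ 5) * (E * h) + - (z ^ 4 + const (+ 5) * E) * h  ≈⟨ ~-+ˡ (- z + const (+ 5) * (E * h)) (~-*ʳ h (~-neg Φ′~0)) ⟩
    - z + const (+ 5) * (E * h) + - 0# * h                         ≈⟨ ≋⇒~ (lemma₂ (- z + const (+ 5) * (E * h)) h) ⟩
    - z + const (+ 5) * (E * h)                                    ≈⟨ ≋⇒~ (+ₚ-cong (≋-sym 1-x≋-z) (≋-refl {const (+ 5) * (E * h)})) ⟩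
    1# - X + const (+ 5) * (E * h)                                 ∎
    where
    open ~-Reasoning Φ
    1-x≋-z : 1# - X ≋ - z
    1-x≋-z = ==⇒≋ _ _ tt
    Φ′~0 : z ^ 4 + const (+ 5) * E ~ 0#
    Φ′~0 = ~-trans (≋⇒~ (≋-sym Φ≋z⁴+5E)) modulus~0
    lemma₁ : ∀ z E h → - z * (1# + z ^ 3 * h) ≋ - z + const (+ 5) * (E * h) + - (z ^ 4 + const (+ 5) * E) * h
    lemma₁ = solve-∀ ℤ[x]-solverRing
    lemma₂ : ∀ a h → a + - 0# * h ≋ a
    lemma₂ = solve-∀ ℤ[x]-solverRing

  norm-of-1-x+5Eh : ∀ {m} h → NormIs 1 (1# + z ^ₚ 3 * h) m → NormIs 1 (1# - X + scale (+ 5) (E * h)) (+ 5 ℤ.* m)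
  norm-of-1-x+5Eh {m} h N[1+z³h]≡m = 𝒩~⇒NormIs (1# - X + scale (+ 5) (E * h)) (begin
    𝒩 (1# - X + scale (+ 5) (E * h))    ≈⟨ 𝒩-cong (≋⇒~ (+ₚ-cong (≋-refl {1# - X}) (≋-sym (const-*ₗ (+ 5) (E * h))))) ⟩
    𝒩 (1# - X + const (+ 5) * (E * h))  ≈⟨ 𝒩-cong (~-sym ([1-x]*[1+z³h]~ h)) ⟩
    𝒩 ((1# - X) * (1# + z ^ 3 * h))     ≈⟨ 𝒩-* (1# - X) (1# + z ^ 3 * h) ⟩
    𝒩 (1# - X) * 𝒩 (1# + z ^ 3 * h)     ≈⟨ ~-* 𝒩[1-x]~5 (NormIs⇒𝒩~ (1# + z ^ 3 * h) (NormIs-resp-≋ 1+z^ₚ3h≋ N[1+z³h]≡m)) ⟩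
    const (+ 5) * const m               ≈⟨ ≋⇒~ (≋-sym (const-* (+ 5) m)) ⟩
    const (+ 5 ℤ.* m)                   ∎)
    where
    open ~-Reasoning Φ
    1+z^ₚ3h≋ : 1# + z ^ₚ 3 * h ≋ 1# + z ^ 3 * h
    1+z^ₚ3h≋ = +ₚ-cong (≋-refl {1#}) (*ₚ-congˡ h z^ₚ3≋z^3)

  Eh-at-1 : ∀ h → eval (E * h) (+ 1) ≡ eval h (+ 1)
  Eh-at-1 h = ≡.trans (eval-* E h (+ 1)) (ℤ.*-identityˡ (eval h (+ 1)))

open Residue using (norm-of-1+z³h)
open Case-i≡1 using (E; norm-of-1-x+5Eh; Eh-at-1)
open import Data.Nat using (suc; _≤_; s≤s; z≤n)
open import Data.Integer as ℤ using (ℤ; +_; _*_)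
open import Data.Integer.Divisibility using (_∣_)
open import Data.Integer.Divisibility.Signed using (∣⇒∣ᵤ)
open import Data.Product using (_,_; _×_; ∃-syntax; proj₁; proj₂)
open import Function using (_∘_)
open import Relation.Binary.PropositionalEquality as ≡ using (_≡_; refl)
open import Relation.Nullary using (¬_)

lemma3p2 : (i : ℕ) → 1 ≤ i → (m : ℤ) → ¬ (+ 5 ∣ m) → (∃[ f ] NormIs i f m) →
    (∃[ h ] NormIs i (const (+ 1) +ₚ (X +ₚ negₚ (const (+ 1))) ^ₚ 3 *ₚ h) m)
    × (i ≡ 1 →
        (∃[ g ] NormIs 1 (const (+ 1) +ₚ negₚ X +ₚ scale (+ 5) g) (+ 5 * m))
        × ((h : Poly) → NormIs 1 (const (+ 1) +ₚ (X +ₚ negₚ (const (+ 1))) ^ₚ 3 *ₚ h) m →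
            ¬ (+ 5 ∣ eval h (+ 1)) →
            ∃[ g ] (NormIs 1 (const (+ 1) +ₚ negₚ X +ₚ scale (+ 5) g) (+ 5 * m)
                    × ¬ (+ 5 ∣ eval g (+ 1)))))
lemma3p2 (suc k) (s≤s z≤n) m 5∤m (f , N[f]≡m) = (h₀ , N[1+z³h₀]≡m) , λ { refl →
    (E *ₚ h₀ , norm-of-1-x+5Eh h₀ N[1+z³h₀]≡m) ,
    λ h N[1+z³h]≡m 5∤h[1] → E *ₚ h , norm-of-1-x+5Eh h N[1+z³h]≡m , 5∤h[1] ∘ ≡.subst (+ 5 ∣_) (Eh-at-1 h) }
  where
  h₀ = norm-of-1+z³h k f (5∤m ∘ ∣⇒∣ᵤ) N[f]≡m .proj₁
  N[1+z³h₀]≡m = norm-of-1+z³h k f (5∤m ∘ ∣⇒∣ᵤ) N[f]≡m .proj₂
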